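{- Let $m$ be a positive integer, let $n\in\{2,4,6,\ldots\}$, and let $i=\sqrt{ -1}$. Then $$\sum_{\substack{0\le k\le n\\ 4\mid k-2}}\binom nk(-1)^{\frac{k-2}4}2^{n-\frac k2}m^kB_{n-k}=\frac n2\Big\{m^{n-1}\Big((-1)^{\lfloor\frac{n-2}4\rfloor}2^{\frac n2}-(1+(-1)^m)(-1)^{\frac n2}\Big)+2i\sum_{r=1}^{\lfloor\frac{m-1}2\rfloor}\Big((2r-m-mi)^{n-1}-(2r-m+mi)^{n-1}\Big)\Big\}.$$
   Context: The Bernoulli numbers $B_n$ are defined by $B_0=1$ and $\sum_{k=0}^{n-1}\binom nkB_k=0$ for $n\ge 2$. $\lfloor y\rfloor$ denotes the greatest integer not exceeding $y$. -}

module Defs where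

open import Data.Nat as ℕ using (ℕ; zero; suc; _∸_; _≤?_)
open import Data.Nat.Divisibility using (_∣?_)
open import Data.Nat.Combinatorics using (_C_)
open import Data.Integer as ℤ using (ℤ; +_)
open import Data.Rational as ℚ using (ℚ; 0ℚ; 1ℚ; _+_; _*_; -_; _-_; _/_)
open import Data.List using (List; []; _∷_; _++_; [_])
open import Data.Bool using (Bool; true; false; if_then_else_; _∧_)
open import Relation.Nullary.Decidable using (does)

ℕ→ℚ : ℕ → ℚ
ℕ→ℚ n = (+ n) / 1

ℤ→ℚ : ℤ → ℚ
ℤ→ℚ z = z / 1

_^ℚ_ : ℚ → ℕ → ℚ
x ^ℚ zero  = 1ℚ
x ^ℚ suc n = x * (x ^ℚ n)

sumFrom : ℕ → ℕ → (ℕ → ℚ) → ℚ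
sumFrom a zero    f = 0ℚ
sumFrom a (suc l) f = f a + sumFrom (suc a) l f

Σ[_⋯_] : ℕ → ℕ → (ℕ → ℚ) → ℚ
Σ[ a ⋯ b ] f = sumFrom a (suc b ∸ a) f

-- Bernoulli numbers: B₀ = 1 and Σ_{k=0}^{n-1} C(n,k) B_k = 0 for n ≥ 2,
-- i.e. B_{n} = -(1/(n+1)) Σ_{k=0}^{n-1} C(n+1,k) B_k for n ≥ 1.
-- bernList n = [B₀, …, B_n]
private
  lookupD : List ℚ → ℕ → ℚ
  lookupD []       _       = 0ℚ
  lookupD (x ∷ xs) zero    = x
  lookupD (x ∷ xs) (suc k) = lookupD xs k

bernList : ℕ → List ℚ
bernList zero    = [ 1ℚ ]
bernList (suc n) =
  bernList n ++
  [ - ((+ 1 / suc (suc n)) *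
       Σ[ 0 ⋯ n ] (λ k → ℕ→ℚ (suc (suc n) C k) * lookupD (bernList n) k)) ]

B : ℕ → ℚ
B n = lookupD (bernList n) n

record ℚi : Set where
  constructor _+i_
  field
    re : ℚ
    im : ℚ
open ℚi public

infixl 6 _⊕_ _⊖_
infixl 7 _⊛_

_⊕_ : ℚi → ℚi → ℚi
(a +i b) ⊕ (c +i d) = (a + c) +i (b + d)

_⊖_ : ℚi → ℚi → ℚi
(a +i b) ⊖ (c +i d) = (a - c) +i (b - d)

_⊛_ : ℚi → ℚi → ℚi
(a +i b) ⊛ (c +i d) = ((a * c) - (b * d)) +i ((a * d) + (b * c))

ι : ℚ → ℚi
ι x = x +i 0ℚ

𝕚 : ℚi
𝕚 = 0ℚ +i 1ℚ

_^i_ : ℚi → ℕ → ℚi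
z ^i zero  = ι 1ℚ
z ^i suc n = z ⊛ (z ^i n)

Σi[_⋯_] : ℕ → ℕ → (ℕ → ℚi) → ℚi
Σi[ a ⋯ b ] f = go a (suc b ∸ a)
  where
  go : ℕ → ℕ → ℚi
  go a zero    = ι 0ℚ
  go a (suc l) = f a ⊕ go (suc a) l

-- indicator of the summation condition "4 ∣ k - 2" (k - 2 as an integer;
-- for k < 2 the integer k - 2 ∈ {-2,-1} is not divisible by 4)
fourDivKMinus2 : ℕ → Bool
fourDivKMinus2 k = does (2 ≤? k) ∧ does (4 ∣? (k ∸ 2))

LHS : ℕ → ℕ → ℚ
LHS m n = Σ[ 0 ⋯ n ] (λ k →
  if fourDivKMinus2 k
  then ℕ→ℚ (n C k) * ((- 1ℚ) ^ℚ ((k ∸ 2) ℕ./ 4)) * (ℕ→ℚ 2 ^ℚ (n ∸ (k ℕ./ 2)))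
       * (ℕ→ℚ m ^ℚ k) * B (n ∸ k)
  else 0ℚ)

RHS : ℕ → ℕ → ℚi
RHS m n =
  ι (ℕ→ℚ n * (+ 1 / 2)) ⊛
    ( ι ((ℕ→ℚ m ^ℚ (n ∸ 1)) *
         (((- 1ℚ) ^ℚ ((n ∸ 2) ℕ./ 4)) * (ℕ→ℚ 2 ^ℚ (n ℕ./ 2))
          - ((1ℚ + ((- 1ℚ) ^ℚ m)) * ((- 1ℚ) ^ℚ (n ℕ./ 2)))))
    ⊕ (ι (ℕ→ℚ 2) ⊛ 𝕚) ⊛
      Σi[ 1 ⋯ (m ∸ 1) ℕ./ 2 ] (λ r →
        ((ι (ℤ→ℚ ((+ (2 ℕ.* r)) ℤ.- (+ m))) ⊖ (ι (ℕ→ℚ m) ⊛ 𝕚)) ^i (n ∸ 1))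
        ⊖ ((ι (ℤ→ℚ ((+ (2 ℕ.* r)) ℤ.- (+ m))) ⊕ (ι (ℕ→ℚ m) ⊛ 𝕚)) ^i (n ∸ 1))))

module Submission where

-- The summands with k ≡ 2 (mod 4) are extracted from the Bernoulli polynomial
-- B_n(y) = Σ_k C(n,k) B_(n−k) y^k with the fourth roots of unity:
-- 1 − 𝕚^k + (−1)^k − (−𝕚)^k is 4 if k ≡ 2 (mod 4) and 0 otherwise.
-- For y = m(1 + 𝕚)/2 one has 𝕚y = y − m and −𝕚y = −y + m, so the left-hand side
-- is (−𝕚 2ⁿ/4)(B_n(y) − B_n(y − m) + B_n(−y) − B_n(−y + m)), and the difference
-- equation B_n(x + 1) − B_n(x) = n x^(n−1), a consequence of the recurrence
-- defining the B_k, turns it into (n/2) 𝕚 Σ_(j<m) D_j with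
-- D_j = (2j − m − m𝕚)^(n−1) − (2j − m + m𝕚)^(n−1).  As n − 1 is odd,
-- D_(m−j) = D_j, so the sum folds onto 1 ≤ r ≤ ⌊(m−1)/2⌋, and the end terms D_0
-- and, for even m, D_(m/2) give the closed-form part of the right-hand side.

open import Defs
open import Level using (0ℓ)
open import Function using (_∘_)
open import Data.Bool using (true; false; if_then_else_)
open import Data.Empty using (⊥-elim)
open import Data.Maybe using (Maybe; just; nothing)
open import Data.Product using (Σ; _,_; proj₁; proj₂)
open import Data.Sum using (inj₁; inj₂)
open import Data.List using (List; []; _∷_; _++_; [_]; length)
import Data.List.Properties as List
open import Data.Nat as ℕ using (ℕ; zero; suc; _∸_; _≤_; _<_; z≤n; s≤s; _!)
import Data.Nat.Properties as ℕ
open import Data.Nat.DivMod using (m/n*n≡m; m*n/n≡m; m/n≡1+[m∸n]/n; m≡m%n+[m/n]*n; m%n<n)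
open import Data.Nat.Divisibility using (_∣_; _∣?_; divides)
open import Data.Nat.Combinatorics
  using (_C_; nCk+nC[k+1]≡[n+1]C[k+1]; k>n⇒nCk≡0; nCk≡nC[n∸k]; nCn≡1; nC1≡n; k![n∸k]!∣n!)
open import Data.Nat.Combinatorics.Specification using (nCk≡n!/k![n-k]!)
import Data.Nat.Tactic.RingSolver as ℕ-Solver
open import Data.Integer as ℤ using (+_)
import Data.Integer.Properties as ℤ
open import Data.Rational as ℚ using (ℚ; 0ℚ; 1ℚ; _/_; toℚᵘ)
import Data.Rational.Properties as ℚ
open import Data.Rational.Solver using (module +-*-Solver)
open import Data.Rational.Unnormalised as ℚᵘ using (mkℚᵘ; *≡*)
import Data.Rational.Unnormalised.Properties as ℚᵘ
open import Relation.Binary.PropositionalEquality hiding ([_])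
open import Relation.Nullary using (yes; no; contradiction)
open import Relation.Nullary.Decidable using (dec-true; _×-dec_; proof)
open import Relation.Nullary.Reflects using (Reflects; invert)
open import Algebra using (CommutativeRing)
open import Algebra.Structures {A = ℚi} _≡_ using (IsCommutativeRing)
open import Algebra.Consequences.Propositional
  using (comm∧idˡ⇒id; comm∧invˡ⇒inv; comm∧distrˡ⇒distrʳ)
import Tactic.RingSolver.Core.AlmostCommutativeRing as ACR
open import Tactic.RingSolver using (solve-∀)

infix 8 ⊝_

⊝_ : ℚi → ℚi
⊝ (a +i b) = (ℚ.- a) +i (ℚ.- b)

0i 1i : ℚi
0i = ι 0ℚ
1i = ι 1ℚ

⊕-assoc : ∀ x y z → (x ⊕ y) ⊕ z ≡ x ⊕ (y ⊕ z)
⊕-assoc (a +i b) (c +i d) (e +i f) = cong₂ _+i_ (ℚ.+-assoc a c e) (ℚ.+-assoc b d f)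

⊕-comm : ∀ x y → x ⊕ y ≡ y ⊕ x
⊕-comm (a +i b) (c +i d) = cong₂ _+i_ (ℚ.+-comm a c) (ℚ.+-comm b d)

⊕-identityˡ : ∀ x → 0i ⊕ x ≡ x
⊕-identityˡ (a +i b) = cong₂ _+i_ (ℚ.+-identityˡ a) (ℚ.+-identityˡ b)

⊕-inverseˡ : ∀ x → ⊝ x ⊕ x ≡ 0i
⊕-inverseˡ (a +i b) = cong₂ _+i_ (ℚ.+-inverseˡ a) (ℚ.+-inverseˡ b)

module _ where
  open +-*-Solver renaming (solve to solveℚ)

  ⊛-assoc : ∀ x y z → (x ⊛ y) ⊛ z ≡ x ⊛ (y ⊛ z)
  ⊛-assoc (a +i b) (c +i d) (e +i f) = cong₂ _+i_
    (solveℚ 6 (λ a b c d e f → (a :* c :- b :* d) :* e :- (a :* d :+ b :* c) :* f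
                 := a :* (c :* e :- d :* f) :- b :* (c :* f :+ d :* e)) refl a b c d e f)
    (solveℚ 6 (λ a b c d e f → (a :* c :- b :* d) :* f :+ (a :* d :+ b :* c) :* e
                 := a :* (c :* f :+ d :* e) :+ b :* (c :* e :- d :* f)) refl a b c d e f)

  ⊛-comm : ∀ x y → x ⊛ y ≡ y ⊛ x
  ⊛-comm (a +i b) (c +i d) = cong₂ _+i_
    (solveℚ 4 (λ a b c d → a :* c :- b :* d := c :* a :- d :* b) refl a b c d)
    (solveℚ 4 (λ a b c d → a :* d :+ b :* c := c :* b :+ d :* a) refl a b c d)

  ⊛-identityˡ : ∀ x → 1i ⊛ x ≡ x
  ⊛-identityˡ (a +i b) = cong₂ _+i_
    (solveℚ 2 (λ a b → con 1ℚ :* a :- con 0ℚ :* b := a) refl a b)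
    (solveℚ 2 (λ a b → con 1ℚ :* b :+ con 0ℚ :* a := b) refl a b)

  ⊛-distribˡ-⊕ : ∀ x y z → x ⊛ (y ⊕ z) ≡ x ⊛ y ⊕ x ⊛ z
  ⊛-distribˡ-⊕ (a +i b) (c +i d) (e +i f) = cong₂ _+i_
    (solveℚ 6 (λ a b c d e f → a :* (c :+ e) :- b :* (d :+ f)
                 := (a :* c :- b :* d) :+ (a :* e :- b :* f)) refl a b c d e f)
    (solveℚ 6 (λ a b c d e f → a :* (d :+ f) :+ b :* (c :+ e)
                 := (a :* d :+ b :* c) :+ (a :* f :+ b :* e)) refl a b c d e f)

  ι-homo-* : ∀ a b → ι (a ℚ.* b) ≡ ι a ⊛ ι b
  ι-homo-* a b = cong₂ _+i_
    (solveℚ 2 (λ a b → a :* b := a :* b :- con 0ℚ :* con 0ℚ) refl a b)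
    (solveℚ 2 (λ a b → con 0ℚ := a :* con 0ℚ :+ con 0ℚ :* b) refl a b)

ℚi-isCommutativeRing : IsCommutativeRing _⊕_ _⊛_ ⊝_ 0i 1i
ℚi-isCommutativeRing = record
  { isRing = record
    { +-isAbelianGroup = record
      { isGroup = record
        { isMonoid = record
          { isSemigroup = record
            { isMagma = record { isEquivalence = isEquivalence ; ∙-cong = cong₂ _⊕_ }
            ; assoc = ⊕-assoc }
          ; identity = comm∧idˡ⇒id ⊕-comm ⊕-identityˡ }
        ; inverse = comm∧invˡ⇒inv ⊕-comm ⊕-inverseˡ
        ; ⁻¹-cong = cong ⊝_ }
      ; comm = ⊕-comm }
    ; *-cong = cong₂ _⊛_
    ; *-assoc = ⊛-assoc
    ; *-identity = comm∧idˡ⇒id ⊛-comm ⊛-identityˡ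
    ; distrib = ⊛-distribˡ-⊕ , comm∧distrˡ⇒distrʳ ⊛-comm ⊛-distribˡ-⊕ }
  ; *-comm = ⊛-comm }

ℚi-commutativeRing : CommutativeRing 0ℓ 0ℓ
ℚi-commutativeRing = record { isCommutativeRing = ℚi-isCommutativeRing }

-- Closed terms such as 𝕚 or w are constants for the solver, which multiplies them out:
-- it knows 𝕚 ⊛ 𝕚 ≡ ⊝ 1i.  It does not see through _⊖_, so lemmas are stated with ⊕ ⊝.
ℚi-ring : ACR.AlmostCommutativeRing 0ℓ 0ℓ
ℚi-ring = ACR.fromCommutativeRing ℚi-commutativeRing 0≟_
  where
  0≟_ : ∀ x → Maybe (0i ≡ x)
  0≟ (a +i b) with 0ℚ ℚ.≟ a | 0ℚ ℚ.≟ b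
  ... | yes p | yes q = just (cong₂ _+i_ p q)
  ... | _     | _     = nothing

open CommutativeRing ℚi-commutativeRing public
  using () renaming (+-identityʳ to ⊕-identityʳ; *-identityʳ to ⊛-identityʳ;
                     zeroʳ to ⊛-zeroʳ; zeroˡ to ⊛-zeroˡ)

toℚᵘ-ℤ→ℚ : ∀ z → toℚᵘ (ℤ→ℚ z) ℚᵘ.≃ mkℚᵘ z 0
toℚᵘ-ℤ→ℚ z = ℚ.toℚᵘ-fromℚᵘ (mkℚᵘ z 0)

ℤ→ℚ-homo-+ : ∀ a b → ℤ→ℚ (a ℤ.+ b) ≡ ℤ→ℚ a ℚ.+ ℤ→ℚ b
ℤ→ℚ-homo-+ a b = ℚ.toℚᵘ-injective (begin
  toℚᵘ (ℤ→ℚ (a ℤ.+ b))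
    ≈⟨ toℚᵘ-ℤ→ℚ (a ℤ.+ b) ⟩
  mkℚᵘ (a ℤ.+ b) 0
    ≈⟨ *≡* (cong₂ ℤ._*_ (cong₂ ℤ._+_ (sym (ℤ.*-identityʳ a)) (sym (ℤ.*-identityʳ b))) refl) ⟩
  mkℚᵘ a 0 ℚᵘ.+ mkℚᵘ b 0
    ≈⟨ ℚᵘ.+-cong (toℚᵘ-ℤ→ℚ a) (toℚᵘ-ℤ→ℚ b) ⟨
  toℚᵘ (ℤ→ℚ a) ℚᵘ.+ toℚᵘ (ℤ→ℚ b)
    ≈⟨ ℚ.toℚᵘ-homo-+ (ℤ→ℚ a) (ℤ→ℚ b) ⟨
  toℚᵘ (ℤ→ℚ a ℚ.+ ℤ→ℚ b) ∎)
  where open ℚᵘ.≃-Reasoning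

ℤ→ℚ-homo-* : ∀ a b → ℤ→ℚ (a ℤ.* b) ≡ ℤ→ℚ a ℚ.* ℤ→ℚ b
ℤ→ℚ-homo-* a b = ℚ.toℚᵘ-injective (begin
  toℚᵘ (ℤ→ℚ (a ℤ.* b))                ≈⟨ toℚᵘ-ℤ→ℚ (a ℤ.* b) ⟩
  mkℚᵘ (a ℤ.* b) 0                     ≈⟨ ℚᵘ.*-cong (toℚᵘ-ℤ→ℚ a) (toℚᵘ-ℤ→ℚ b) ⟨
  toℚᵘ (ℤ→ℚ a) ℚᵘ.* toℚᵘ (ℤ→ℚ b)      ≈⟨ ℚ.toℚᵘ-homo-* (ℤ→ℚ a) (ℤ→ℚ b) ⟨
  toℚᵘ (ℤ→ℚ a ℚ.* ℤ→ℚ b) ∎)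
  where open ℚᵘ.≃-Reasoning

ℤ→ℚ-homo-neg : ∀ a → ℤ→ℚ (ℤ.- a) ≡ ℚ.- ℤ→ℚ a
ℤ→ℚ-homo-neg a = ℚ.toℚᵘ-injective (begin
  toℚᵘ (ℤ→ℚ (ℤ.- a))                  ≈⟨ toℚᵘ-ℤ→ℚ (ℤ.- a) ⟩
  mkℚᵘ (ℤ.- a) 0                       ≈⟨ ℚᵘ.-‿cong (toℚᵘ-ℤ→ℚ a) ⟨
  ℚᵘ.- toℚᵘ (ℤ→ℚ a)                    ≈⟨ ℚ.toℚᵘ-homo‿- (ℤ→ℚ a) ⟨
  toℚᵘ (ℚ.- ℤ→ℚ a) ∎)
  where open ℚᵘ.≃-Reasoning

1/n*n≡1 : ∀ d → (+ 1 / suc d) ℚ.* ℕ→ℚ (suc d) ≡ 1ℚ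
1/n*n≡1 d = ℚ.toℚᵘ-injective (begin
  toℚᵘ ((+ 1 / suc d) ℚ.* ℕ→ℚ (suc d))
    ≈⟨ ℚ.toℚᵘ-homo-* (+ 1 / suc d) (ℕ→ℚ (suc d)) ⟩
  toℚᵘ (+ 1 / suc d) ℚᵘ.* toℚᵘ (ℕ→ℚ (suc d))
    ≈⟨ ℚᵘ.*-cong (ℚ.toℚᵘ-fromℚᵘ (mkℚᵘ (+ 1) d)) (toℚᵘ-ℤ→ℚ (+ suc d)) ⟩
  mkℚᵘ (+ 1) d ℚᵘ.* mkℚᵘ (+ suc d) 0
    ≈⟨ *≡* (cong (λ k → + suc k) (trans (cong (ℕ._* 1) (ℕ.+-identityʳ d)) (sym (ℕ.+-identityʳ (d ℕ.* 1))))) ⟩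
  toℚᵘ 1ℚ ∎)
  where open ℚᵘ.≃-Reasoning

ℕ→ℚi : ℕ → ℚi
ℕ→ℚi k = ι (ℕ→ℚ k)

two : ℚi
two = ℕ→ℚi 2

ℕ→ℚi-homo-+ : ∀ a b → ℕ→ℚi (a ℕ.+ b) ≡ ℕ→ℚi a ⊕ ℕ→ℚi b
ℕ→ℚi-homo-+ a b = cong ι (ℤ→ℚ-homo-+ (+ a) (+ b))

ℕ→ℚi-homo-* : ∀ a b → ℕ→ℚi (a ℕ.* b) ≡ ℕ→ℚi a ⊛ ℕ→ℚi b
ℕ→ℚi-homo-* a b = begin
  ι (ℤ→ℚ (+ (a ℕ.* b)))          ≡⟨ cong (ι ∘ ℤ→ℚ) (ℤ.pos-* a b) ⟩
  ι (ℤ→ℚ (+ a ℤ.* + b))          ≡⟨ cong ι (ℤ→ℚ-homo-* (+ a) (+ b)) ⟩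
  ι (ℕ→ℚ a ℚ.* ℕ→ℚ b)           ≡⟨ ι-homo-* (ℕ→ℚ a) (ℕ→ℚ b) ⟩
  ℕ→ℚi a ⊛ ℕ→ℚi b ∎
  where open ≡-Reasoning

ι-homo-^ : ∀ a k → ι (a ^ℚ k) ≡ ι a ^i k
ι-homo-^ a zero    = refl
ι-homo-^ a (suc k) = trans (ι-homo-* a (a ^ℚ k)) (cong (ι a ⊛_) (ι-homo-^ a k))

^i-homo-⊛ : ∀ x a b → x ^i (a ℕ.+ b) ≡ x ^i a ⊛ x ^i b
^i-homo-⊛ x zero    b = sym (⊛-identityˡ _)
^i-homo-⊛ x (suc a) b = trans (cong (x ⊛_) (^i-homo-⊛ x a b)) (sym (⊛-assoc x _ _))

^i-distrib-⊛ : ∀ x y k → (x ⊛ y) ^i k ≡ x ^i k ⊛ y ^i k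
^i-distrib-⊛ x y zero    = refl
^i-distrib-⊛ x y (suc k) = trans (cong ((x ⊛ y) ⊛_) (^i-distrib-⊛ x y k)) (lemma x y (x ^i k) (y ^i k))
  where
  lemma : ∀ x y p q → (x ⊛ y) ⊛ (p ⊛ q) ≡ (x ⊛ p) ⊛ (y ⊛ q)
  lemma = solve-∀ ℚi-ring

^i-assocʳ : ∀ x a b → (x ^i a) ^i b ≡ x ^i (a ℕ.* b)
^i-assocʳ x a zero    = cong (x ^i_) (sym (ℕ.*-zeroʳ a))
^i-assocʳ x a (suc b) = begin
  x ^i a ⊛ (x ^i a) ^i b      ≡⟨ cong (x ^i a ⊛_) (^i-assocʳ x a b) ⟩
  x ^i a ⊛ x ^i (a ℕ.* b)     ≡⟨ ^i-homo-⊛ x a (a ℕ.* b) ⟨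
  x ^i (a ℕ.+ a ℕ.* b)        ≡⟨ cong (x ^i_) (ℕ.*-suc a b) ⟨
  x ^i (a ℕ.* suc b) ∎
  where open ≡-Reasoning

1^i≡1 : ∀ k → 1i ^i k ≡ 1i
1^i≡1 zero    = refl
1^i≡1 (suc k) = trans (⊛-identityˡ _) (1^i≡1 k)

⊝^i-even : ∀ x t → (⊝ x) ^i (t ℕ.* 2) ≡ x ^i (t ℕ.* 2)
⊝^i-even x zero    = refl
⊝^i-even x (suc t) = trans (cong (λ p → ⊝ x ⊛ (⊝ x ⊛ p)) (⊝^i-even x t)) (lemma x (x ^i (t ℕ.* 2)))
  where
  lemma : ∀ x p → ⊝ x ⊛ (⊝ x ⊛ p) ≡ x ⊛ (x ⊛ p)
  lemma = solve-∀ ℚi-ring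

⊝^i-odd : ∀ x t → (⊝ x) ^i suc (t ℕ.* 2) ≡ ⊝ (x ^i suc (t ℕ.* 2))
⊝^i-odd x t = trans (cong (⊝ x ⊛_) (⊝^i-even x t)) (lemma x (x ^i (t ℕ.* 2)))
  where
  lemma : ∀ x p → ⊝ x ⊛ p ≡ ⊝ (x ⊛ p)
  lemma = solve-∀ ℚi-ring

^i-periodic : ∀ x → x ^i 4 ≡ 1i → ∀ r q → x ^i (r ℕ.+ q ℕ.* 4) ≡ x ^i r
^i-periodic x x⁴≡1 r q = begin
  x ^i (r ℕ.+ q ℕ.* 4)        ≡⟨ ^i-homo-⊛ x r (q ℕ.* 4) ⟩
  x ^i r ⊛ x ^i (q ℕ.* 4)     ≡⟨ cong (λ k → x ^i r ⊛ x ^i k) (ℕ.*-comm q 4) ⟩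
  x ^i r ⊛ x ^i (4 ℕ.* q)     ≡⟨ cong (x ^i r ⊛_) (^i-assocʳ x 4 q) ⟨
  x ^i r ⊛ (x ^i 4) ^i q      ≡⟨ cong (λ y → x ^i r ⊛ y ^i q) x⁴≡1 ⟩
  x ^i r ⊛ 1i ^i q            ≡⟨ cong (x ^i r ⊛_) (1^i≡1 q) ⟩
  x ^i r ⊛ 1i                 ≡⟨ ⊛-identityʳ _ ⟩
  x ^i r ∎
  where open ≡-Reasoning

𝕚^[2k]≡[-1]^k : ∀ k → 𝕚 ^i (k ℕ.* 2) ≡ (⊝ 1i) ^i k
𝕚^[2k]≡[-1]^k k = trans (cong (𝕚 ^i_) (ℕ.*-comm k 2)) (sym (^i-assocʳ 𝕚 2 k))

[-1]^[2k]≡1 : ∀ k → (⊝ 1i) ^i (k ℕ.* 2) ≡ 1i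
[-1]^[2k]≡1 k = trans (⊝^i-even 1i k) (1^i≡1 (k ℕ.* 2))

sum : ℕ → (ℕ → ℚi) → ℚi
sum zero    f = 0i
sum (suc l) f = f 0 ⊕ sum l (f ∘ suc)

syntax sum l (λ j → e) = ∑[ j < l ] e

sum-cong : ∀ l {f g} → (∀ j → j < l → f j ≡ g j) → sum l f ≡ sum l g
sum-cong zero    eq = refl
sum-cong (suc l) eq = cong₂ _⊕_ (eq 0 (s≤s z≤n)) (sum-cong l (λ j j<l → eq (suc j) (s≤s j<l)))

sum-zero : ∀ l f → (∀ j → f j ≡ 0i) → sum l f ≡ 0i
sum-zero zero    f eq = refl
sum-zero (suc l) f eq = trans (cong₂ _⊕_ (eq 0) (sum-zero l (f ∘ suc) (eq ∘ suc))) (⊕-identityˡ 0i)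

sum-distrib-⊕ : ∀ l f g → ∑[ j < l ] (f j ⊕ g j) ≡ sum l f ⊕ sum l g
sum-distrib-⊕ zero    f g = sym (⊕-identityˡ 0i)
sum-distrib-⊕ (suc l) f g =
  trans (cong (f 0 ⊕ g 0 ⊕_) (sum-distrib-⊕ l (f ∘ suc) (g ∘ suc)))
        (interchange (f 0) (g 0) (sum l (f ∘ suc)) (sum l (g ∘ suc)))
  where
  interchange : ∀ a b c d → (a ⊕ b) ⊕ (c ⊕ d) ≡ (a ⊕ c) ⊕ (b ⊕ d)
  interchange = solve-∀ ℚi-ring

sum-distrib-⊝ : ∀ l f → ⊝ sum l f ≡ ∑[ j < l ] (⊝ f j)
sum-distrib-⊝ zero    f = refl
sum-distrib-⊝ (suc l) f =
  trans (⊝-distrib (f 0) (sum l (f ∘ suc))) (cong (⊝ f 0 ⊕_) (sum-distrib-⊝ l (f ∘ suc)))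
  where
  ⊝-distrib : ∀ a b → ⊝ (a ⊕ b) ≡ ⊝ a ⊕ ⊝ b
  ⊝-distrib = solve-∀ ℚi-ring

sum-distrib-⊖ : ∀ l f g → ∑[ j < l ] (f j ⊖ g j) ≡ sum l f ⊖ sum l g
sum-distrib-⊖ l f g =
  trans (sum-distrib-⊕ l f (λ j → ⊝ g j)) (cong (sum l f ⊕_) (sym (sum-distrib-⊝ l g)))

⊛-distribˡ-sum : ∀ l c f → c ⊛ sum l f ≡ ∑[ j < l ] (c ⊛ f j)
⊛-distribˡ-sum zero    c f = ⊛-zeroʳ c
⊛-distribˡ-sum (suc l) c f =
  trans (⊛-distribˡ-⊕ c (f 0) _) (cong (c ⊛ f 0 ⊕_) (⊛-distribˡ-sum l c (f ∘ suc)))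

sum-init-last : ∀ l f → sum (suc l) f ≡ sum l f ⊕ f l
sum-init-last zero    f = ⊕-comm (f 0) 0i
sum-init-last (suc l) f =
  trans (cong (f 0 ⊕_) (sum-init-last l (f ∘ suc))) (sym (⊕-assoc (f 0) _ _))

sum-split : ∀ a b f → sum (a ℕ.+ b) f ≡ sum a f ⊕ ∑[ j < b ] f (a ℕ.+ j)
sum-split zero    b f = sym (⊕-identityˡ _)
sum-split (suc a) b f =
  trans (cong (f 0 ⊕_) (sum-split a b (f ∘ suc))) (sym (⊕-assoc (f 0) _ _))

sum-reverse : ∀ l f → sum l f ≡ ∑[ j < l ] f (l ∸ suc j)
sum-reverse zero    f = refl
sum-reverse (suc l) f = begin
  f 0 ⊕ sum l (f ∘ suc)
    ≡⟨ cong (f 0 ⊕_) (sum-reverse l (f ∘ suc)) ⟩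
  f 0 ⊕ ∑[ j < l ] f (suc (l ∸ suc j))
    ≡⟨ ⊕-comm (f 0) _ ⟩
  ∑[ j < l ] f (suc (l ∸ suc j)) ⊕ f 0              ≡⟨ cong₂ _⊕_ (sum-cong l λ j j<l → cong f (sym (ℕ.+-∸-assoc 1 j<l)))
                                                                  (cong f (sym (ℕ.n∸n≡0 l))) ⟩
  ∑[ j < l ] f (suc l ∸ suc j) ⊕ f (suc l ∸ suc l)
    ≡⟨ sum-init-last l (λ j → f (suc l ∸ suc j)) ⟨
  ∑[ j < suc l ] f (suc l ∸ suc j) ∎
  where open ≡-Reasoning

sum-comm : ∀ a b (g : ℕ → ℕ → ℚi) → ∑[ i < a ] sum b (g i) ≡ ∑[ j < b ] ∑[ i < a ] g i j
sum-comm zero    b g = sym (sum-zero b _ λ _ → refl)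
sum-comm (suc a) b g =
  trans (cong (sum b (g 0) ⊕_) (sum-comm a b (g ∘ suc))) (sym (sum-distrib-⊕ b (g 0) _))

sum-single : ∀ l p f → p < l → (∀ j → j ≢ p → f j ≡ 0i) → sum l f ≡ f p
sum-single (suc l) zero    f _ others =
  trans (cong (f 0 ⊕_) (sum-zero l (f ∘ suc) λ j → others (suc j) λ ())) (⊕-identityʳ (f 0))
sum-single (suc l) (suc p) f (s≤s p<l) others =
  trans (cong₂ _⊕_ (others 0 λ ()) (sum-single l p (f ∘ suc) p<l λ j j≢p → others (suc j) (j≢p ∘ ℕ.suc-injective)))
        (⊕-identityˡ _)

sum-palindrome : ∀ h k g → (∀ j → j < h → g (h ℕ.+ k ℕ.+ (h ∸ suc j)) ≡ g j) →
  sum (h ℕ.+ k ℕ.+ h) g ≡ two ⊛ sum h g ⊕ ∑[ i < k ] g (h ℕ.+ i)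
sum-palindrome h k g mirror = begin
  sum (h ℕ.+ k ℕ.+ h) g                                       ≡⟨ sum-split (h ℕ.+ k) h g ⟩
  sum (h ℕ.+ k) g ⊕ ∑[ j < h ] g (h ℕ.+ k ℕ.+ j)               ≡⟨ cong₂ _⊕_ (sum-split h k g)
                                                                    (trans (sum-reverse h _) (sum-cong h mirror)) ⟩
  sum h g ⊕ ∑[ i < k ] g (h ℕ.+ i) ⊕ sum h g                   ≡⟨ double (sum h g) (∑[ i < k ] g (h ℕ.+ i)) ⟩
  two ⊛ sum h g ⊕ ∑[ i < k ] g (h ℕ.+ i) ∎
  where
  open ≡-Reasoning
  double : ∀ s c → s ⊕ c ⊕ s ≡ two ⊛ s ⊕ c
  double = solve-∀ ℚi-ring

ι-sumFrom : ∀ a l f → ι (sumFrom a l f) ≡ ∑[ j < l ] ι (f (a ℕ.+ j))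
ι-sumFrom a zero    f = refl
ι-sumFrom a (suc l) f = cong₂ _⊕_
  (cong (ι ∘ f) (sym (ℕ.+-identityʳ a)))
  (trans (ι-sumFrom (suc a) l f) (sum-cong l λ j _ → cong (ι ∘ f) (sym (ℕ.+-suc a j))))

Σi-step : ∀ a b f → a ≤ b → Σi[ a ⋯ b ] f ≡ f a ⊕ Σi[ suc a ⋯ b ] f
Σi-step a b f a≤b rewrite ℕ.+-∸-assoc 1 a≤b = refl

Σi-empty : ∀ a b f → b < a → Σi[ a ⋯ b ] f ≡ 0i
Σi-empty a b f b<a rewrite ℕ.m≤n⇒m∸n≡0 b<a = refl

Σi≡sum : ∀ l a b f → suc b ∸ a ≡ l → Σi[ a ⋯ b ] f ≡ ∑[ j < l ] f (a ℕ.+ j)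
Σi≡sum zero    a b f len = Σi-empty a b f (ℕ.m∸n≡0⇒m≤n len)
Σi≡sum (suc l) a b f len with a ℕ.≤? b
... | yes a≤b = trans (Σi-step a b f a≤b) (cong₂ _⊕_
  (cong f (sym (ℕ.+-identityʳ a)))
  (trans (Σi≡sum l (suc a) b f (ℕ.suc-injective (trans (sym (ℕ.+-∸-assoc 1 a≤b)) len)))
         (sum-cong l λ j _ → cong f (sym (ℕ.+-suc a j)))))
... | no a≰b with () ← trans (sym (ℕ.m≤n⇒m∸n≡0 (ℕ.≰⇒> a≰b))) len

C-suc : ∀ n → suc n C n ≡ suc n
C-suc n = begin
  suc n C n               ≡⟨ nCk≡nC[n∸k] (ℕ.n≤1+n n) ⟩
  suc n C (suc n ∸ n)     ≡⟨ cong (suc n C_) (ℕ.m+n∸n≡m 1 n) ⟩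
  suc n C 1               ≡⟨ nC1≡n (suc n) ⟩
  suc n ∎
  where open ≡-Reasoning

nCk*[k!*[n∸k]!]≡n! : ∀ {n k} → k ≤ n → (n C k) ℕ.* (k ! ℕ.* (n ∸ k) !) ≡ n !
nCk*[k!*[n∸k]!]≡n! {n} {k} k≤n =
  trans (cong (ℕ._* (k ! ℕ.* (n ∸ k) !)) (nCk≡n!/k![n-k]! k≤n))
        (m/n*n≡m {{ℕ._!*_!≢0 k (n ∸ k)}} (k![n∸k]!∣n! k≤n))

C-twice≡multinomial : ∀ n i j → i ℕ.+ j ≤ n →
  (n C j) ℕ.* ((n ∸ j) C i) ℕ.* (j ! ℕ.* (i ! ℕ.* (n ∸ j ∸ i) !)) ≡ n !
C-twice≡multinomial n i j i+j≤n = begin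
  (n C j) ℕ.* ((n ∸ j) C i) ℕ.* (j ! ℕ.* (i ! ℕ.* (n ∸ j ∸ i) !))
    ≡⟨ rearrange (n C j) ((n ∸ j) C i) (j !) (i !) ((n ∸ j ∸ i) !) ⟩
  (n C j) ℕ.* (j ! ℕ.* (((n ∸ j) C i) ℕ.* (i ! ℕ.* (n ∸ j ∸ i) !)))
    ≡⟨ cong (λ r → (n C j) ℕ.* (j ! ℕ.* r)) (nCk*[k!*[n∸k]!]≡n! i≤n∸j) ⟩
  (n C j) ℕ.* (j ! ℕ.* (n ∸ j) !)
    ≡⟨ nCk*[k!*[n∸k]!]≡n! (ℕ.≤-trans (ℕ.m≤n+m j i) i+j≤n) ⟩
  n ! ∎
  where
  open ≡-Reasoning
  rearrange : ∀ a b c d e → a ℕ.* b ℕ.* (c ℕ.* (d ℕ.* e)) ≡ a ℕ.* (c ℕ.* (b ℕ.* (d ℕ.* e)))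
  rearrange = ℕ-Solver.solve-∀
  i≤n∸j : i ≤ n ∸ j
  i≤n∸j = subst (_≤ n ∸ j) (ℕ.m+n∸n≡m i j) (ℕ.∸-monoˡ-≤ j i+j≤n)

C-twice-vanishes : ∀ n i j → n < i ℕ.+ j → (n C j) ℕ.* ((n ∸ j) C i) ≡ 0
C-twice-vanishes n i j n<i+j with j ℕ.≤? n
... | yes j≤n = trans (cong ((n C j) ℕ.*_) (k>n⇒nCk≡0 n∸j<i)) (ℕ.*-zeroʳ (n C j))
  where
  n∸j<i : n ∸ j < i
  n∸j<i = ℕ.+-cancelʳ-< j (n ∸ j) i (subst (_< i ℕ.+ j) (sym (ℕ.m∸n+n≡m j≤n)) n<i+j)
... | no  j≰n = cong (ℕ._* ((n ∸ j) C i)) (k>n⇒nCk≡0 (ℕ.≰⇒> j≰n))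

C-twice-comm : ∀ n i j → (n C j) ℕ.* ((n ∸ j) C i) ≡ (n C i) ℕ.* ((n ∸ i) C j)
C-twice-comm n i j with i ℕ.+ j ℕ.≤? n
... | yes i+j≤n = ℕ.*-cancelʳ-≡ _ _ (j ! ℕ.* (i ! ℕ.* (n ∸ j ∸ i) !)) {{nonZero}} (begin
  (n C j) ℕ.* ((n ∸ j) C i) ℕ.* (j ! ℕ.* (i ! ℕ.* (n ∸ j ∸ i) !))
    ≡⟨ C-twice≡multinomial n i j i+j≤n ⟩
  n !
    ≡⟨ C-twice≡multinomial n j i (subst (_≤ n) (ℕ.+-comm i j) i+j≤n) ⟨
  (n C i) ℕ.* ((n ∸ i) C j) ℕ.* (i ! ℕ.* (j ! ℕ.* (n ∸ i ∸ j) !))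
    ≡⟨ cong (λ k → (n C i) ℕ.* ((n ∸ i) C j) ℕ.* (i ! ℕ.* (j ! ℕ.* k !))) ∸-comm ⟩
  (n C i) ℕ.* ((n ∸ i) C j) ℕ.* (i ! ℕ.* (j ! ℕ.* (n ∸ j ∸ i) !))
    ≡⟨ cong (λ r → (n C i) ℕ.* ((n ∸ i) C j) ℕ.* r) (swap (i !) (j !) ((n ∸ j ∸ i) !)) ⟩
  (n C i) ℕ.* ((n ∸ i) C j) ℕ.* (j ! ℕ.* (i ! ℕ.* (n ∸ j ∸ i) !)) ∎)
  where
  open ≡-Reasoning
  nonZero = ℕ.m*n≢0 _ _ {{ℕ._!≢0 j}} {{ℕ._!*_!≢0 i (n ∸ j ∸ i)}}
  swap : ∀ a b c → a ℕ.* (b ℕ.* c) ≡ b ℕ.* (a ℕ.* c)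
  swap = ℕ-Solver.solve-∀
  ∸-comm : n ∸ i ∸ j ≡ n ∸ j ∸ i
  ∸-comm = trans (ℕ.∸-+-assoc n i j) (trans (cong (n ∸_) (ℕ.+-comm i j)) (sym (ℕ.∸-+-assoc n j i)))
... | no  i+j≰n = trans (C-twice-vanishes n i j n<i+j) (sym (C-twice-vanishes n j i (subst (n <_) (ℕ.+-comm i j) n<i+j)))
  where
  n<i+j = ℕ.≰⇒> i+j≰n

module _ (x : ℚi) where

  binomialTerm : ℕ → ℕ → ℚi
  binomialTerm e i = ℕ→ℚi (e C i) ⊛ x ^i i

  binomialTerm-vanishes : ∀ {e i} → e < i → binomialTerm e i ≡ 0i
  binomialTerm-vanishes {e} {i} e<i = trans (cong (λ c → ℕ→ℚi c ⊛ x ^i i) (k>n⇒nCk≡0 e<i)) (⊛-zeroˡ (x ^i i))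

  binomialTerm-pascal : ∀ e i → binomialTerm (suc e) (suc i) ≡ x ⊛ binomialTerm e i ⊕ binomialTerm e (suc i)
  binomialTerm-pascal e i = begin
    ℕ→ℚi (suc e C suc i) ⊛ x ^i suc i
      ≡⟨ cong (λ c → ℕ→ℚi c ⊛ x ^i suc i) (nCk+nC[k+1]≡[n+1]C[k+1] e i) ⟨
    ℕ→ℚi (e C i ℕ.+ e C suc i) ⊛ (x ⊛ x ^i i)
      ≡⟨ cong (_⊛ (x ⊛ x ^i i)) (ℕ→ℚi-homo-+ (e C i) (e C suc i)) ⟩
    (ℕ→ℚi (e C i) ⊕ ℕ→ℚi (e C suc i)) ⊛ (x ⊛ x ^i i)
      ≡⟨ lemma (ℕ→ℚi (e C i)) (ℕ→ℚi (e C suc i)) x (x ^i i) ⟩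
    x ⊛ binomialTerm e i ⊕ binomialTerm e (suc i) ∎
    where
    open ≡-Reasoning
    lemma : ∀ c d x p → (c ⊕ d) ⊛ (x ⊛ p) ≡ x ⊛ (c ⊛ p) ⊕ d ⊛ (x ⊛ p)
    lemma = solve-∀ ℚi-ring

  binomial-theorem : ∀ M e → e < M → (x ⊕ 1i) ^i e ≡ ∑[ i < M ] binomialTerm e i
  binomial-theorem (suc M) zero    _ = sym (sum-single (suc M) 0 (binomialTerm 0) (s≤s z≤n) λ
    { zero    0≢0 → ⊥-elim (0≢0 refl)
    ; (suc i) _   → binomialTerm-vanishes {i = suc i} (s≤s z≤n)
    })
  binomial-theorem (suc M) (suc e) (s≤s e<M) = begin
    (x ⊕ 1i) ⊛ (x ⊕ 1i) ^i e
      ≡⟨ cong ((x ⊕ 1i) ⊛_) (binomial-theorem (suc M) e (ℕ.m≤n⇒m≤1+n e<M)) ⟩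
    (x ⊕ 1i) ⊛ (t 0 ⊕ sum M (t ∘ suc))
      ≡⟨ lemma x (t 0) (sum M (t ∘ suc)) ⟩
    t 0 ⊕ (x ⊛ (t 0 ⊕ sum M (t ∘ suc)) ⊕ sum M (t ∘ suc))
      ≡⟨ cong (λ s → t 0 ⊕ (x ⊛ s ⊕ sum M (t ∘ suc))) (begin
           sum (suc M) t
             ≡⟨ sum-init-last M t ⟩
           sum M t ⊕ t M
             ≡⟨ cong (sum M t ⊕_) (binomialTerm-vanishes e<M) ⟩
           sum M t ⊕ 0i
             ≡⟨ ⊕-identityʳ _ ⟩
           sum M t ∎) ⟩
    t 0 ⊕ (x ⊛ sum M t ⊕ sum M (t ∘ suc))           ≡⟨ cong (λ s → t 0 ⊕ (s ⊕ sum M (t ∘ suc))) (⊛-distribˡ-sum M x t) ⟩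
    t 0 ⊕ (∑[ i < M ] (x ⊛ t i) ⊕ sum M (t ∘ suc))  ≡⟨ cong (t 0 ⊕_) (sum-distrib-⊕ M (λ i → x ⊛ t i) (t ∘ suc)) ⟨
    t 0 ⊕ ∑[ i < M ] (x ⊛ t i ⊕ t (suc i))          ≡⟨ cong (t 0 ⊕_) (sum-cong M λ i _ → binomialTerm-pascal e i) ⟨
    ∑[ i < suc M ] binomialTerm (suc e) i ∎
    where
    open ≡-Reasoning
    t = binomialTerm e
    lemma : ∀ x t s → (x ⊕ 1i) ⊛ (t ⊕ s) ≡ t ⊕ (x ⊛ (t ⊕ s) ⊕ s)
    lemma = solve-∀ ℚi-ring

-- `B n` is a lookup into `bernList n` by a function private to `Defs`;
-- abstracting over `bernList n` lets unification recover that function.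
bernoulliLookup : Σ (List ℚ → ℕ → ℚ) λ lookup → ∀ n → B n ≡ lookup (bernList n) n
bernoulliLookup = lookup , spec
  where
  lookup : List ℚ → ℕ → ℚ
  lookup = _
  spec : ∀ n → B n ≡ lookup (bernList n) n
  spec n with bernList n
  ... | xs = refl

private
  lookup : List ℚ → ℕ → ℚ
  lookup = proj₁ bernoulliLookup

lookup-++ : ∀ xs y k → k < length xs → lookup (xs ++ [ y ]) k ≡ lookup xs k
lookup-++ (x ∷ xs) y zero    _         = refl
lookup-++ (x ∷ xs) y (suc k) (s≤s k<l) = lookup-++ xs y k k<l

lookup-last : ∀ xs y → lookup (xs ++ [ y ]) (length xs) ≡ y
lookup-last []       y = refl
lookup-last (x ∷ xs) y = lookup-last xs y

length-bernList : ∀ n → length (bernList n) ≡ suc n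
length-bernList zero    = refl
length-bernList (suc n) =
  trans (List.length-++ (bernList n)) (trans (cong (ℕ._+ 1) (length-bernList n)) (ℕ.+-comm (suc n) 1))

lookup-bernList : ∀ {n k} → k ≤ n → lookup (bernList n) k ≡ B k
lookup-bernList {zero}  z≤n = refl
lookup-bernList {suc n} {k} k≤1+n with ℕ.m≤n⇒m<n∨m≡n k≤1+n
... | inj₁ (s≤s k≤n) = trans (lookup-++ (bernList n) _ k (subst (k <_) (sym (length-bernList n)) (s≤s k≤n)))
                             (lookup-bernList k≤n)
... | inj₂ refl      = refl

sumFrom-cong : ∀ a l {f g} → (∀ k → k < a ℕ.+ l → f k ≡ g k) → sumFrom a l f ≡ sumFrom a l g
sumFrom-cong a zero    eq = refl
sumFrom-cong a (suc l) eq = cong₂ ℚ._+_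
  (eq a (ℕ.m<m+n a (s≤s z≤n)))
  (sumFrom-cong (suc a) l λ k k< → eq k (subst (k <_) (sym (ℕ.+-suc a l)) k<))

B-suc : ∀ n → B (suc n) ≡
  ℚ.- ((+ 1 / suc (suc n)) ℚ.* Σ[ 0 ⋯ n ] (λ k → ℕ→ℚ (suc (suc n) C k) ℚ.* B k))
B-suc n = begin
  B (suc n)
    ≡⟨ proj₂ bernoulliLookup (suc n) ⟩
  lookup (bernList n ++ [ y ]) (suc n)
    ≡⟨ cong (lookup (bernList n ++ [ y ])) (length-bernList n) ⟨
  lookup (bernList n ++ [ y ]) (length (bernList n))
    ≡⟨ lookup-last (bernList n) y ⟩
  y
    ≡⟨ cong (λ s → ℚ.- (c ℚ.* s)) (sumFrom-cong 0 (suc n) λ k k<1+n →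
         cong (ℕ→ℚ (suc (suc n) C k) ℚ.*_) (lookup-bernList (ℕ.≤-pred k<1+n))) ⟩
  ℚ.- (c ℚ.* Σ[ 0 ⋯ n ] (λ k → ℕ→ℚ (suc (suc n) C k) ℚ.* B k)) ∎
  where
  open ≡-Reasoning
  c = + 1 / suc (suc n)
  y = ℚ.- (c ℚ.* Σ[ 0 ⋯ n ] (λ k → ℕ→ℚ (suc (suc n) C k) ℚ.* lookup (bernList n) k))

Bi : ℕ → ℚi
Bi = ι ∘ B

δ₁ : ℕ → ℚi
δ₁ 1 = 1i
δ₁ _ = 0i

bernoulli-recurrence : ∀ N → ∑[ j < N ] (ℕ→ℚi (N C j) ⊛ Bi j) ≡ δ₁ N
bernoulli-recurrence zero          = refl
bernoulli-recurrence (suc zero)    = refl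
bernoulli-recurrence (suc (suc n)) = begin
  sum (2 ℕ.+ n) f
    ≡⟨ sum-init-last (suc n) f ⟩
  sum (suc n) f ⊕ f (suc n)
    ≡⟨ cong₂ _⊕_ init (cong₂ _⊛_ (cong ℕ→ℚi (C-suc (suc n))) (trans (cong ι (B-suc n)) (cong ⊝_ (ι-homo-* c s)))) ⟩
  ι s ⊕ ℕ→ℚi (2 ℕ.+ n) ⊛ ⊝ (ι c ⊛ ι s)
    ≡⟨ cancel (ι s) (ℕ→ℚi (2 ℕ.+ n)) (ι c) ⟩
  ι s ⊕ ⊝ ((ι c ⊛ ℕ→ℚi (2 ℕ.+ n)) ⊛ ι s)
    ≡⟨ cong (λ u → ι s ⊕ ⊝ (u ⊛ ι s)) (trans (sym (ι-homo-* c _)) (cong ι (1/n*n≡1 (suc n)))) ⟩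
  ι s ⊕ ⊝ (1i ⊛ ι s)
    ≡⟨ inverse (ι s) ⟩
  0i ∎
  where
  open ≡-Reasoning
  f : ℕ → ℚi
  f j = ℕ→ℚi (suc (suc n) C j) ⊛ Bi j
  g : ℕ → ℚ
  g k = ℕ→ℚ (suc (suc n) C k) ℚ.* B k
  c = + 1 / suc (suc n)
  s = Σ[ 0 ⋯ n ] g
  init : sum (suc n) f ≡ ι s
  init = trans (sum-cong (suc n) λ j _ → sym (ι-homo-* (ℕ→ℚ (suc (suc n) C j)) (B j)))
               (sym (ι-sumFrom 0 (suc n) g))
  cancel : ∀ s d c → s ⊕ d ⊛ ⊝ (c ⊛ s) ≡ s ⊕ ⊝ ((c ⊛ d) ⊛ s)
  cancel = solve-∀ ℚi-ring
  inverse : ∀ s → s ⊕ ⊝ (1i ⊛ s) ≡ 0i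
  inverse = solve-∀ ℚi-ring

bernoulli-recurrence-padded : ∀ n N → N ≤ n → ∑[ j < suc n ] (ℕ→ℚi (N C j) ⊛ Bi j) ≡ Bi N ⊕ δ₁ N
bernoulli-recurrence-padded n N N≤n = begin
  sum (suc n) f
    ≡⟨ cong (λ l → sum l f) (cong suc (ℕ.m+[n∸m]≡n N≤n)) ⟨
  sum (suc N ℕ.+ (n ∸ N)) f
    ≡⟨ sum-split (suc N) (n ∸ N) f ⟩
  sum (suc N) f ⊕ ∑[ j < n ∸ N ] f (suc N ℕ.+ j) ≡⟨ cong (sum (suc N) f ⊕_) (sum-zero (n ∸ N) _ beyond) ⟩
  sum (suc N) f ⊕ 0i
    ≡⟨ ⊕-identityʳ _ ⟩
  sum (suc N) f
    ≡⟨ sum-init-last N f ⟩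
  sum N f ⊕ f N
    ≡⟨ cong₂ _⊕_ (bernoulli-recurrence N) (cong (λ c → ℕ→ℚi c ⊛ Bi N) (nCn≡1 N)) ⟩
  δ₁ N ⊕ 1i ⊛ Bi N
    ≡⟨ cong (δ₁ N ⊕_) (⊛-identityˡ (Bi N)) ⟩
  δ₁ N ⊕ Bi N
    ≡⟨ ⊕-comm (δ₁ N) (Bi N) ⟩
  Bi N ⊕ δ₁ N ∎
  where
  open ≡-Reasoning
  f : ℕ → ℚi
  f j = ℕ→ℚi (N C j) ⊛ Bi j
  beyond : ∀ j → f (suc N ℕ.+ j) ≡ 0i
  beyond j = trans (cong (λ c → ℕ→ℚi c ⊛ Bi (suc N ℕ.+ j)) (k>n⇒nCk≡0 (s≤s (ℕ.m≤m+n N j)))) (⊛-zeroˡ (Bi (suc N ℕ.+ j)))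

-- Bernoulli polynomials

bernoulliPoly : ℕ → ℚi → ℚi
bernoulliPoly N y = ∑[ i < suc N ] (ℕ→ℚi (N C i) ⊛ Bi (N ∸ i) ⊛ y ^i i)

bernoulliPoly-reverse : ∀ N y → ∑[ j < suc N ] (ℕ→ℚi (N C j) ⊛ Bi j ⊛ y ^i (N ∸ j)) ≡ bernoulliPoly N y
bernoulliPoly-reverse N y =
  trans (sum-reverse (suc N) λ j → ℕ→ℚi (N C j) ⊛ Bi j ⊛ y ^i (N ∸ j)) (sum-cong (suc N) λ i i<1+N → cong₂
    (λ c k → ℕ→ℚi c ⊛ Bi (N ∸ i) ⊛ y ^i k)
    (sym (nCk≡nC[n∸k] (ℕ.≤-pred i<1+N)))
    (ℕ.m∸[m∸n]≡n (ℕ.≤-pred i<1+N)))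

δ₁[1+n∸i]≡0 : ∀ n i → i ≢ n → δ₁ (suc n ∸ i) ≡ 0i
δ₁[1+n∸i]≡0 zero    zero          0≢0 = ⊥-elim (0≢0 refl)
δ₁[1+n∸i]≡0 zero    (suc zero)    _   = refl
δ₁[1+n∸i]≡0 zero    (suc (suc _)) _   = refl
δ₁[1+n∸i]≡0 (suc n) zero          _   = refl
δ₁[1+n∸i]≡0 (suc n) (suc i)       i≢n = δ₁[1+n∸i]≡0 n i (i≢n ∘ cong suc)

bernoulliPoly-difference : ∀ n x → bernoulliPoly (suc n) (x ⊕ 1i) ≡ bernoulliPoly (suc n) x ⊕ ℕ→ℚi (suc n) ⊛ x ^i n
bernoulliPoly-difference n x = begin
  bernoulliPoly N (x ⊕ 1i)
    ≡⟨ bernoulliPoly-reverse N (x ⊕ 1i) ⟨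
  ∑[ j < M ] (c j ⊛ (x ⊕ 1i) ^i (N ∸ j))
    ≡⟨ sum-cong M (λ j _ → cong (c j ⊛_) (binomial-theorem x M (N ∸ j) (s≤s (ℕ.m∸n≤m N j)))) ⟩
  ∑[ j < M ] (c j ⊛ ∑[ i < M ] binomialTerm x (N ∸ j) i)
    ≡⟨ sum-cong M (λ j _ → ⊛-distribˡ-sum M (c j) (binomialTerm x (N ∸ j))) ⟩
  ∑[ j < M ] ∑[ i < M ] (c j ⊛ binomialTerm x (N ∸ j) i)
    ≡⟨ sum-comm M M (λ j i → c j ⊛ binomialTerm x (N ∸ j) i) ⟩
  ∑[ i < M ] ∑[ j < M ] (c j ⊛ binomialTerm x (N ∸ j) i)
    ≡⟨ sum-cong M (λ i _ → trans (sum-cong M λ j _ → regroup i j)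
                                 (sym (⊛-distribˡ-sum M (binomialTerm x N i) λ j → ℕ→ℚi ((N ∸ i) C j) ⊛ Bi j))) ⟩
  ∑[ i < M ] (binomialTerm x N i ⊛ ∑[ j < M ] (ℕ→ℚi ((N ∸ i) C j) ⊛ Bi j))
    ≡⟨ sum-cong M (λ i _ → cong (binomialTerm x N i ⊛_) (bernoulli-recurrence-padded N (N ∸ i) (ℕ.m∸n≤m N i))) ⟩
  ∑[ i < M ] (binomialTerm x N i ⊛ (Bi (N ∸ i) ⊕ δ₁ (N ∸ i)))
    ≡⟨ sum-cong M (λ i _ → distrib (ℕ→ℚi (N C i)) (x ^i i) (Bi (N ∸ i)) (δ₁ (N ∸ i))) ⟩
  ∑[ i < M ] (ℕ→ℚi (N C i) ⊛ Bi (N ∸ i) ⊛ x ^i i ⊕ binomialTerm x N i ⊛ δ₁ (N ∸ i))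
    ≡⟨ sum-distrib-⊕ M (λ i → ℕ→ℚi (N C i) ⊛ Bi (N ∸ i) ⊛ x ^i i) (λ i → binomialTerm x N i ⊛ δ₁ (N ∸ i)) ⟩
  bernoulliPoly N x ⊕ ∑[ i < M ] (binomialTerm x N i ⊛ δ₁ (N ∸ i))
    ≡⟨ cong (bernoulliPoly N x ⊕_) (sum-single M n (λ i → binomialTerm x N i ⊛ δ₁ (N ∸ i)) (s≤s (ℕ.n≤1+n n)) λ i i≢n →
         trans (cong (binomialTerm x N i ⊛_) (δ₁[1+n∸i]≡0 n i i≢n)) (⊛-zeroʳ (binomialTerm x N i))) ⟩
  bernoulliPoly N x ⊕ binomialTerm x N n ⊛ δ₁ (N ∸ n)
    ≡⟨ cong₂ (λ k l → bernoulliPoly N x ⊕ ℕ→ℚi k ⊛ x ^i n ⊛ δ₁ l) (C-suc n) (ℕ.m+n∸n≡m 1 n) ⟩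
  bernoulliPoly N x ⊕ ℕ→ℚi N ⊛ x ^i n ⊛ 1i
    ≡⟨ cong (bernoulliPoly N x ⊕_) (⊛-identityʳ _) ⟩
  bernoulliPoly N x ⊕ ℕ→ℚi N ⊛ x ^i n ∎
  where
  open ≡-Reasoning
  N = suc n
  M = suc N
  c : ℕ → ℚi
  c j = ℕ→ℚi (N C j) ⊛ Bi j
  regroup : ∀ i j → c j ⊛ binomialTerm x (N ∸ j) i ≡ binomialTerm x N i ⊛ (ℕ→ℚi ((N ∸ i) C j) ⊛ Bi j)
  regroup i j = begin
    ℕ→ℚi (N C j) ⊛ Bi j ⊛ (ℕ→ℚi ((N ∸ j) C i) ⊛ x ^i i)
      ≡⟨ swap₁ (ℕ→ℚi (N C j)) (Bi j) (ℕ→ℚi ((N ∸ j) C i)) (x ^i i) ⟩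
    ℕ→ℚi (N C j) ⊛ ℕ→ℚi ((N ∸ j) C i) ⊛ (Bi j ⊛ x ^i i)
      ≡⟨ cong (_⊛ (Bi j ⊛ x ^i i)) (begin
           ℕ→ℚi (N C j) ⊛ ℕ→ℚi ((N ∸ j) C i)   ≡⟨ ℕ→ℚi-homo-* (N C j) _ ⟨
           ℕ→ℚi ((N C j) ℕ.* ((N ∸ j) C i))    ≡⟨ cong ℕ→ℚi (C-twice-comm N i j) ⟩
           ℕ→ℚi ((N C i) ℕ.* ((N ∸ i) C j))    ≡⟨ ℕ→ℚi-homo-* (N C i) _ ⟩
           ℕ→ℚi (N C i) ⊛ ℕ→ℚi ((N ∸ i) C j) ∎) ⟩
    ℕ→ℚi (N C i) ⊛ ℕ→ℚi ((N ∸ i) C j) ⊛ (Bi j ⊛ x ^i i)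
      ≡⟨ swap₂ (ℕ→ℚi (N C i)) (ℕ→ℚi ((N ∸ i) C j)) (Bi j) (x ^i i) ⟩
    ℕ→ℚi (N C i) ⊛ x ^i i ⊛ (ℕ→ℚi ((N ∸ i) C j) ⊛ Bi j) ∎
    where
    swap₁ : ∀ a b c p → a ⊛ b ⊛ (c ⊛ p) ≡ a ⊛ c ⊛ (b ⊛ p)
    swap₁ = solve-∀ ℚi-ring
    swap₂ : ∀ a c b p → a ⊛ c ⊛ (b ⊛ p) ≡ a ⊛ p ⊛ (c ⊛ b)
    swap₂ = solve-∀ ℚi-ring
  distrib : ∀ c p b d → c ⊛ p ⊛ (b ⊕ d) ≡ c ⊛ b ⊛ p ⊕ c ⊛ p ⊛ d
  distrib = solve-∀ ℚi-ring

bernoulliPoly-shift : ∀ n x m →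
  bernoulliPoly (suc n) (x ⊕ ℕ→ℚi m) ≡ bernoulliPoly (suc n) x ⊕ ℕ→ℚi (suc n) ⊛ ∑[ j < m ] ((x ⊕ ℕ→ℚi j) ^i n)
bernoulliPoly-shift n x zero    = begin
  bernoulliPoly (suc n) (x ⊕ 0i)                  ≡⟨ cong (bernoulliPoly (suc n)) (⊕-identityʳ x) ⟩
  bernoulliPoly (suc n) x                         ≡⟨ ⊕-identityʳ _ ⟨
  bernoulliPoly (suc n) x ⊕ 0i                    ≡⟨ cong (bernoulliPoly (suc n) x ⊕_) (⊛-zeroʳ (ℕ→ℚi (suc n))) ⟨
  bernoulliPoly (suc n) x ⊕ ℕ→ℚi (suc n) ⊛ 0i ∎
  where open ≡-Reasoning
bernoulliPoly-shift n x (suc m) = begin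
  P (x ⊕ ℕ→ℚi (suc m))
    ≡⟨ cong P (trans (cong (x ⊕_) (trans (cong ℕ→ℚi (ℕ.+-comm 1 m)) (ℕ→ℚi-homo-+ m 1))) (sym (⊕-assoc x _ 1i))) ⟩
  P ((x ⊕ ℕ→ℚi m) ⊕ 1i)
    ≡⟨ bernoulliPoly-difference n (x ⊕ ℕ→ℚi m) ⟩
  P (x ⊕ ℕ→ℚi m) ⊕ c ⊛ (x ⊕ ℕ→ℚi m) ^i n
    ≡⟨ cong (_⊕ c ⊛ (x ⊕ ℕ→ℚi m) ^i n) (bernoulliPoly-shift n x m) ⟩
  P x ⊕ c ⊛ s ⊕ c ⊛ (x ⊕ ℕ→ℚi m) ^i n
    ≡⟨ collect (P x) c s ((x ⊕ ℕ→ℚi m) ^i n) ⟩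
  P x ⊕ c ⊛ (s ⊕ (x ⊕ ℕ→ℚi m) ^i n)
    ≡⟨ cong (λ t → P x ⊕ c ⊛ t) (sum-init-last m λ j → (x ⊕ ℕ→ℚi j) ^i n) ⟨
  P x ⊕ c ⊛ ∑[ j < suc m ] ((x ⊕ ℕ→ℚi j) ^i n) ∎
  where
  open ≡-Reasoning
  P = bernoulliPoly (suc n)
  c = ℕ→ℚi (suc n)
  s = ∑[ j < m ] ((x ⊕ ℕ→ℚi j) ^i n)
  collect : ∀ p c s t → p ⊕ c ⊛ s ⊕ c ⊛ t ≡ p ⊕ c ⊛ (s ⊕ t)
  collect = solve-∀ ℚi-ring

-- Filtering by the fourth roots of unity

-- Σ ζ⁻² ζᵏ over the fourth roots of unity ζ.
fourthRootFilter : ℕ → ℚi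
fourthRootFilter k = 1i ⊕ ⊝ 𝕚 ^i k ⊕ ((⊝ 1i) ^i k ⊕ ⊝ (⊝ 𝕚) ^i k)

fourthRootFilter-periodic : ∀ r q → fourthRootFilter (r ℕ.+ q ℕ.* 4) ≡ fourthRootFilter r
fourthRootFilter-periodic r q = cong₂ (λ a p → 1i ⊕ ⊝ a ⊕ p)
  (^i-periodic 𝕚 refl r q)
  (cong₂ (λ a b → a ⊕ ⊝ b) (^i-periodic (⊝ 1i) refl r q) (^i-periodic (⊝ 𝕚) refl r q))

fourDivKMinus2-2+4q : ∀ q → fourDivKMinus2 (2 ℕ.+ q ℕ.* 4) ≡ true
fourDivKMinus2-2+4q q = dec-true (4 ∣? (q ℕ.* 4)) (divides q refl)

fourDivKMinus2-true : ∀ k → fourDivKMinus2 k ≡ true → Σ ℕ λ q → k ≡ 2 ℕ.+ q ℕ.* 4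
fourDivKMinus2-true k eq with invert (subst (Reflects _) eq (proof ((2 ℕ.≤? k) ×-dec (4 ∣? (k ∸ 2)))))
... | 2≤k , divides q k∸2≡q*4 = q , trans (sym (ℕ.m+[n∸m]≡n 2≤k)) (cong (2 ℕ.+_) k∸2≡q*4)

fourthRootFilter-vanishes : ∀ k → fourDivKMinus2 k ≡ false → fourthRootFilter k ≡ 0i
fourthRootFilter-vanishes k eq =
  trans (cong fourthRootFilter (m≡m%n+[m/n]*n k 4))
        (trans (fourthRootFilter-periodic (k ℕ.% 4) (k ℕ./ 4)) (residue (k ℕ.% 4) (m%n<n k 4) refl))
  where
  residue : ∀ r → r < 4 → k ℕ.% 4 ≡ r → fourthRootFilter r ≡ 0i
  residue 0 _ _ = refl
  residue 1 _ _ = refl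
  residue 3 _ _ = refl
  residue (suc (suc (suc (suc _)))) (s≤s (s≤s (s≤s (s≤s ())))) _
  residue 2 _ k%4≡2 with () ← trans (sym (fourDivKMinus2-2+4q (k ℕ./ 4)))
    (trans (cong fourDivKMinus2 (trans (cong (ℕ._+ (k ℕ./ 4) ℕ.* 4) (sym k%4≡2)) (sym (m≡m%n+[m/n]*n k 4)))) eq)

bernoulliPoly-filtered : ∀ n y → let P = bernoulliPoly n in
  ∑[ k < suc n ] (ℕ→ℚi (n C k) ⊛ Bi (n ∸ k) ⊛ (y ^i k ⊛ fourthRootFilter k))
    ≡ P y ⊕ ⊝ P (𝕚 ⊛ y) ⊕ (P (⊝ 1i ⊛ y) ⊕ ⊝ P (⊝ 𝕚 ⊛ y))
bernoulliPoly-filtered n y = begin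
  ∑[ k < suc n ] (c k ⊛ (y ^i k ⊛ fourthRootFilter k))
    ≡⟨ sum-cong (suc n) (λ k _ → expand k) ⟩
  ∑[ k < suc n ] (t y k ⊕ ⊝ t (𝕚 ⊛ y) k ⊕ (t (⊝ 1i ⊛ y) k ⊕ ⊝ t (⊝ 𝕚 ⊛ y) k))
    ≡⟨ sum-distrib-⊕ (suc n) (λ k → t y k ⊕ ⊝ t (𝕚 ⊛ y) k) (λ k → t (⊝ 1i ⊛ y) k ⊕ ⊝ t (⊝ 𝕚 ⊛ y) k) ⟩
  ∑[ k < suc n ] (t y k ⊕ ⊝ t (𝕚 ⊛ y) k) ⊕ ∑[ k < suc n ] (t (⊝ 1i ⊛ y) k ⊕ ⊝ t (⊝ 𝕚 ⊛ y) k)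
    ≡⟨ cong₂ _⊕_ (sum-distrib-⊖ (suc n) (t y) (t (𝕚 ⊛ y))) (sum-distrib-⊖ (suc n) (t (⊝ 1i ⊛ y)) (t (⊝ 𝕚 ⊛ y))) ⟩
  P y ⊕ ⊝ P (𝕚 ⊛ y) ⊕ (P (⊝ 1i ⊛ y) ⊕ ⊝ P (⊝ 𝕚 ⊛ y)) ∎
  where
  open ≡-Reasoning
  P = bernoulliPoly n
  c : ℕ → ℚi
  c k = ℕ→ℚi (n C k) ⊛ Bi (n ∸ k)
  t : ℚi → ℕ → ℚi
  t z k = c k ⊛ z ^i k
  expand : ∀ k → c k ⊛ (y ^i k ⊛ fourthRootFilter k) ≡ t y k ⊕ ⊝ t (𝕚 ⊛ y) k ⊕ (t (⊝ 1i ⊛ y) k ⊕ ⊝ t (⊝ 𝕚 ⊛ y) k)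
  expand k = begin
    c k ⊛ (y ^i k ⊛ fourthRootFilter k)
      ≡⟨ distribute (c k) (y ^i k) (𝕚 ^i k) ((⊝ 1i) ^i k) ((⊝ 𝕚) ^i k) ⟩
    c k ⊛ y ^i k ⊕ ⊝ (c k ⊛ (𝕚 ^i k ⊛ y ^i k)) ⊕ (c k ⊛ ((⊝ 1i) ^i k ⊛ y ^i k) ⊕ ⊝ (c k ⊛ ((⊝ 𝕚) ^i k ⊛ y ^i k)))
      ≡⟨ cong₂ (λ a b → c k ⊛ y ^i k ⊕ ⊝ (c k ⊛ a) ⊕ b) (sym (^i-distrib-⊛ 𝕚 y k))
               (cong₂ (λ a b → c k ⊛ a ⊕ ⊝ (c k ⊛ b)) (sym (^i-distrib-⊛ (⊝ 1i) y k)) (sym (^i-distrib-⊛ (⊝ 𝕚) y k))) ⟩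
    t y k ⊕ ⊝ t (𝕚 ⊛ y) k ⊕ (t (⊝ 1i ⊛ y) k ⊕ ⊝ t (⊝ 𝕚 ⊛ y) k) ∎
    where
    distribute : ∀ c Y I N J → c ⊛ (Y ⊛ (1i ⊕ ⊝ I ⊕ (N ⊕ ⊝ J))) ≡ c ⊛ Y ⊕ ⊝ (c ⊛ (I ⊛ Y)) ⊕ (c ⊛ (N ⊛ Y) ⊕ ⊝ (c ⊛ (J ⊛ Y)))
    distribute = solve-∀ ℚi-ring

-- The left-hand side as a sum over 0 ≤ j < m

½ : ℚi
½ = ι (+ 1 / 2)

w : ℚi
w = ½ ⊕ ½ ⊛ 𝕚

𝕚⊛Mw⊕M≡Mw : ∀ M → 𝕚 ⊛ (M ⊛ w) ⊕ M ≡ M ⊛ w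
𝕚⊛Mw⊕M≡Mw = solve-∀ ℚi-ring

⊝Mw⊕M≡⊝𝕚⊛Mw : ∀ M → ⊝ 1i ⊛ (M ⊛ w) ⊕ M ≡ ⊝ 𝕚 ⊛ (M ⊛ w)
⊝Mw⊕M≡⊝𝕚⊛Mw = solve-∀ ℚi-ring

-- Since 2w² = 𝕚.
two^[2q+1]⊛w^[4q+2] : ∀ q → two ^i suc (q ℕ.* 2) ⊛ w ^i (2 ℕ.+ q ℕ.* 4) ≡ 𝕚 ⊛ (⊝ 1i) ^i q
two^[2q+1]⊛w^[4q+2] zero    = refl
two^[2q+1]⊛w^[4q+2] (suc q) = begin
  two ⊛ (two ⊛ X) ⊛ (w ⊛ (w ⊛ (w ⊛ (w ⊛ W))))   ≡⟨ step X W ⟩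
  ⊝ 1i ⊛ (X ⊛ W)                                ≡⟨ cong (⊝ 1i ⊛_) (two^[2q+1]⊛w^[4q+2] q) ⟩
  ⊝ 1i ⊛ (𝕚 ⊛ (⊝ 1i) ^i q)                      ≡⟨ swap ((⊝ 1i) ^i q) ⟩
  𝕚 ⊛ (⊝ 1i ⊛ (⊝ 1i) ^i q) ∎
  where
  open ≡-Reasoning
  X = two ^i suc (q ℕ.* 2)
  W = w ^i (2 ℕ.+ q ℕ.* 4)
  step : ∀ X W → two ⊛ (two ⊛ X) ⊛ (w ⊛ (w ⊛ (w ⊛ (w ⊛ W)))) ≡ ⊝ 1i ⊛ (X ⊛ W)
  step = solve-∀ ℚi-ring
  swap : ∀ p → ⊝ 1i ⊛ (𝕚 ⊛ p) ≡ 𝕚 ⊛ (⊝ 1i ⊛ p)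
  swap = solve-∀ ℚi-ring

κ : ℕ → ℚi
κ n = ⊝ 𝕚 ⊛ two ^i n ⊛ ι (+ 1 / 4)

lhsSummand : ℕ → ℕ → ℕ → ℚ
lhsSummand m n k = ℕ→ℚ (n C k) ℚ.* ((ℚ.- 1ℚ) ^ℚ ((k ∸ 2) ℕ./ 4)) ℚ.* (ℕ→ℚ 2 ^ℚ (n ∸ (k ℕ./ 2)))
                   ℚ.* (ℕ→ℚ m ^ℚ k) ℚ.* B (n ∸ k)

lhsSummand-2+4q : ∀ m n q → let k = 2 ℕ.+ q ℕ.* 4 in k ≤ n →
  ι (lhsSummand m n k)
    ≡ κ n ⊛ (ℕ→ℚi (n C k) ⊛ Bi (n ∸ k) ⊛ ((ℕ→ℚi m ⊛ w) ^i k ⊛ fourthRootFilter k))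
lhsSummand-2+4q m n q k≤n = begin
  ι (lhsSummand m n k)
    ≡⟨ cong₂ (λ a b → ι (ℕ→ℚ (n C k) ℚ.* ((ℚ.- 1ℚ) ^ℚ a) ℚ.* (ℕ→ℚ 2 ^ℚ (n ∸ b)) ℚ.* (ℕ→ℚ m ^ℚ k) ℚ.* B (n ∸ k)))
             (m*n/n≡m q 4) k/2≡h ⟩
  ι (ℕ→ℚ (n C k) ℚ.* ((ℚ.- 1ℚ) ^ℚ q) ℚ.* (ℕ→ℚ 2 ^ℚ (n ∸ h)) ℚ.* (ℕ→ℚ m ^ℚ k) ℚ.* B (n ∸ k))
    ≡⟨ ι-homo-*⁵ ⟩
  ι (ℕ→ℚ (n C k)) ⊛ (⊝ 1i) ^i q ⊛ two ^i (n ∸ h) ⊛ ℕ→ℚi m ^i k ⊛ Bi (n ∸ k)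
    ≡⟨ cong (λ p → ι (ℕ→ℚ (n C k)) ⊛ p ⊛ two ^i (n ∸ h) ⊛ ℕ→ℚi m ^i k ⊛ Bi (n ∸ k)) (sym (unit ((⊝ 1i) ^i q))) ⟩
  ι (ℕ→ℚ (n C k)) ⊛ (⊝ 𝕚 ⊛ (𝕚 ⊛ (⊝ 1i) ^i q)) ⊛ two ^i (n ∸ h) ⊛ ℕ→ℚi m ^i k ⊛ Bi (n ∸ k)
    ≡⟨ cong (λ p → ι (ℕ→ℚ (n C k)) ⊛ (⊝ 𝕚 ⊛ p) ⊛ two ^i (n ∸ h) ⊛ ℕ→ℚi m ^i k ⊛ Bi (n ∸ k)) (sym (two^[2q+1]⊛w^[4q+2] q)) ⟩
  ι (ℕ→ℚ (n C k)) ⊛ (⊝ 𝕚 ⊛ (two ^i h ⊛ w ^i k)) ⊛ two ^i (n ∸ h) ⊛ ℕ→ℚi m ^i k ⊛ Bi (n ∸ k)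
    ≡⟨ regroup (ι (ℕ→ℚ (n C k))) (two ^i h) (w ^i k) (two ^i (n ∸ h)) (ℕ→ℚi m ^i k) (Bi (n ∸ k)) ⟩
  ⊝ 𝕚 ⊛ (two ^i (n ∸ h) ⊛ two ^i h) ⊛ ι (+ 1 / 4)
    ⊛ (ι (ℕ→ℚ (n C k)) ⊛ Bi (n ∸ k) ⊛ (ℕ→ℚi m ^i k ⊛ w ^i k ⊛ fourthRootFilter 2))
    ≡⟨ cong₂ (λ p f → ⊝ 𝕚 ⊛ p ⊛ ι (+ 1 / 4) ⊛ (ι (ℕ→ℚ (n C k)) ⊛ Bi (n ∸ k) ⊛ f))
             (trans (sym (^i-homo-⊛ two (n ∸ h) h)) (cong (two ^i_) (ℕ.m∸n+n≡m h≤n)))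
             (cong₂ _⊛_ (sym (^i-distrib-⊛ (ℕ→ℚi m) w k)) (sym (fourthRootFilter-periodic 2 q))) ⟩
  κ n ⊛ (ℕ→ℚi (n C k) ⊛ Bi (n ∸ k) ⊛ ((ℕ→ℚi m ⊛ w) ^i k ⊛ fourthRootFilter k)) ∎
  where
  open ≡-Reasoning
  k = 2 ℕ.+ q ℕ.* 4
  h = suc (q ℕ.* 2)
  k/2≡h : k ℕ./ 2 ≡ h
  k/2≡h = trans (cong (λ x → (2 ℕ.+ x) ℕ./ 2) (sym (ℕ.*-assoc q 2 2))) (m*n/n≡m h 2)
  h≤n : h ≤ n
  h≤n = ℕ.≤-trans (s≤s (ℕ.*-monoʳ-≤ q (s≤s (s≤s z≤n)))) (ℕ.≤-trans (ℕ.n≤1+n _) k≤n)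
  ι-homo-*⁵ : ι (ℕ→ℚ (n C k) ℚ.* ((ℚ.- 1ℚ) ^ℚ q) ℚ.* (ℕ→ℚ 2 ^ℚ (n ∸ h)) ℚ.* (ℕ→ℚ m ^ℚ k) ℚ.* B (n ∸ k))
            ≡ ι (ℕ→ℚ (n C k)) ⊛ (⊝ 1i) ^i q ⊛ two ^i (n ∸ h) ⊛ ℕ→ℚi m ^i k ⊛ Bi (n ∸ k)
  ι-homo-*⁵ =
    trans (ι-homo-* a₃ (B (n ∸ k))) (cong (_⊛ Bi (n ∸ k))
    (trans (ι-homo-* a₂ (ℕ→ℚ m ^ℚ k)) (cong₂ _⊛_
      (trans (ι-homo-* a₁ (ℕ→ℚ 2 ^ℚ (n ∸ h))) (cong₂ _⊛_
        (trans (ι-homo-* (ℕ→ℚ (n C k)) ((ℚ.- 1ℚ) ^ℚ q)) (cong (ι (ℕ→ℚ (n C k)) ⊛_) (ι-homo-^ (ℚ.- 1ℚ) q)))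
        (ι-homo-^ (ℕ→ℚ 2) (n ∸ h))))
      (ι-homo-^ (ℕ→ℚ m) k))))
    where
    a₁ = ℕ→ℚ (n C k) ℚ.* ((ℚ.- 1ℚ) ^ℚ q)
    a₂ = a₁ ℚ.* (ℕ→ℚ 2 ^ℚ (n ∸ h))
    a₃ = a₂ ℚ.* (ℕ→ℚ m ^ℚ k)
  unit : ∀ p → ⊝ 𝕚 ⊛ (𝕚 ⊛ p) ≡ p
  unit = solve-∀ ℚi-ring
  regroup : ∀ c X W T M b → c ⊛ (⊝ 𝕚 ⊛ (X ⊛ W)) ⊛ T ⊛ M ⊛ b
            ≡ ⊝ 𝕚 ⊛ (T ⊛ X) ⊛ ι (+ 1 / 4) ⊛ (c ⊛ b ⊛ (M ⊛ W ⊛ fourthRootFilter 2))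
  regroup = solve-∀ ℚi-ring

lhsTerm-filtered : ∀ m n k → k ≤ n → ∀ b → fourDivKMinus2 k ≡ b →
  ι (if b then lhsSummand m n k else 0ℚ)
    ≡ κ n ⊛ (ℕ→ℚi (n C k) ⊛ Bi (n ∸ k) ⊛ ((ℕ→ℚi m ⊛ w) ^i k ⊛ fourthRootFilter k))
lhsTerm-filtered m n k k≤n false eq =
  sym (trans (cong (λ f → κ n ⊛ (c ⊛ (p ⊛ f))) (fourthRootFilter-vanishes k eq)) (annihilate (κ n) c p))
  where
  c = ℕ→ℚi (n C k) ⊛ Bi (n ∸ k)
  p = (ℕ→ℚi m ⊛ w) ^i k
  annihilate : ∀ a c p → a ⊛ (c ⊛ (p ⊛ 0i)) ≡ 0i
  annihilate = solve-∀ ℚi-ring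
lhsTerm-filtered m n k k≤n true eq =
  let q , k≡2+4q = fourDivKMinus2-true k eq in
  subst (λ k → k ≤ n → ι (lhsSummand m n k)
                       ≡ κ n ⊛ (ℕ→ℚi (n C k) ⊛ Bi (n ∸ k) ⊛ ((ℕ→ℚi m ⊛ w) ^i k ⊛ fourthRootFilter k)))
        (sym k≡2+4q) (lhsSummand-2+4q m n q) k≤n

lhs-as-bernoulliPoly : ∀ m n → let u = ℕ→ℚi m ⊛ w ; P = bernoulliPoly n in
  ι (LHS m n) ≡ κ n ⊛ (P u ⊕ ⊝ P (𝕚 ⊛ u) ⊕ (P (⊝ 1i ⊛ u) ⊕ ⊝ P (⊝ 𝕚 ⊛ u)))
lhs-as-bernoulliPoly m n = begin
  ι (LHS m n)
    ≡⟨ ι-sumFrom 0 (suc n) (λ k → if fourDivKMinus2 k then lhsSummand m n k else 0ℚ) ⟩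
  ∑[ k < suc n ] ι (if fourDivKMinus2 k then lhsSummand m n k else 0ℚ)
    ≡⟨ sum-cong (suc n) (λ k k<1+n → lhsTerm-filtered m n k (ℕ.≤-pred k<1+n) _ refl) ⟩
  ∑[ k < suc n ] (κ n ⊛ filtered k)
    ≡⟨ ⊛-distribˡ-sum (suc n) (κ n) filtered ⟨
  κ n ⊛ sum (suc n) filtered
    ≡⟨ cong (κ n ⊛_) (bernoulliPoly-filtered n u) ⟩
  κ n ⊛ (P u ⊕ ⊝ P (𝕚 ⊛ u) ⊕ (P (⊝ 1i ⊛ u) ⊕ ⊝ P (⊝ 𝕚 ⊛ u))) ∎
  where
  open ≡-Reasoning
  u = ℕ→ℚi m ⊛ w
  P = bernoulliPoly n
  filtered : ℕ → ℚi
  filtered k = ℕ→ℚi (n C k) ⊛ Bi (n ∸ k) ⊛ (u ^i k ⊛ fourthRootFilter k)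

A : ℕ → ℕ → ℚi
A m r = ι (ℤ→ℚ (+ (2 ℕ.* r) ℤ.- + m))

A≡2r-m : ∀ m r → A m r ≡ two ⊛ ℕ→ℚi r ⊕ ⊝ ℕ→ℚi m
A≡2r-m m r = begin
  ι (ℤ→ℚ (+ (2 ℕ.* r) ℤ.+ ℤ.- + m))             ≡⟨ cong ι (ℤ→ℚ-homo-+ (+ (2 ℕ.* r)) (ℤ.- + m)) ⟩
  ℕ→ℚi (2 ℕ.* r) ⊕ ι (ℤ→ℚ (ℤ.- + m))            ≡⟨ cong₂ _⊕_ (ℕ→ℚi-homo-* 2 r) (cong ι (ℤ→ℚ-homo-neg (+ m))) ⟩
  two ⊛ ℕ→ℚi r ⊕ ⊝ ℕ→ℚi m ∎
  where open ≡-Reasoning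

two⊛[𝕚mw⊕j]≡A+m𝕚 : ∀ m j → two ⊛ (𝕚 ⊛ (ℕ→ℚi m ⊛ w) ⊕ ℕ→ℚi j) ≡ A m j ⊕ ℕ→ℚi m ⊛ 𝕚
two⊛[𝕚mw⊕j]≡A+m𝕚 m j = trans (lemma (ℕ→ℚi m) (ℕ→ℚi j)) (cong (_⊕ ℕ→ℚi m ⊛ 𝕚) (sym (A≡2r-m m j)))
  where
  lemma : ∀ M J → two ⊛ (𝕚 ⊛ (M ⊛ w) ⊕ J) ≡ two ⊛ J ⊕ ⊝ M ⊕ M ⊛ 𝕚
  lemma = solve-∀ ℚi-ring

two⊛[⊝mw⊕j]≡A-m𝕚 : ∀ m j → two ⊛ (⊝ 1i ⊛ (ℕ→ℚi m ⊛ w) ⊕ ℕ→ℚi j) ≡ A m j ⊖ ℕ→ℚi m ⊛ 𝕚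
two⊛[⊝mw⊕j]≡A-m𝕚 m j = trans (lemma (ℕ→ℚi m) (ℕ→ℚi j)) (cong (_⊕ ⊝ (ℕ→ℚi m ⊛ 𝕚)) (sym (A≡2r-m m j)))
  where
  lemma : ∀ M J → two ⊛ (⊝ 1i ⊛ (M ⊛ w) ⊕ J) ≡ two ⊛ J ⊕ ⊝ M ⊕ ⊝ (M ⊛ 𝕚)
  lemma = solve-∀ ℚi-ring

D : ℕ → ℕ → ℕ → ℚi
D m e r = (A m r ⊖ ℕ→ℚi m ⊛ 𝕚) ^i e ⊖ (A m r ⊕ ℕ→ℚi m ⊛ 𝕚) ^i e

two^e⊛sum-of-powers : ∀ e l z (f : ℕ → ℚi) → (∀ j → two ⊛ (z ⊕ ℕ→ℚi j) ≡ f j) →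
  two ^i e ⊛ ∑[ j < l ] ((z ⊕ ℕ→ℚi j) ^i e) ≡ ∑[ j < l ] (f j ^i e)
two^e⊛sum-of-powers e l z f eq = trans (⊛-distribˡ-sum l (two ^i e) λ j → (z ⊕ ℕ→ℚi j) ^i e) (sum-cong l λ j _ →
  trans (sym (^i-distrib-⊛ two (z ⊕ ℕ→ℚi j) e)) (cong (_^i e) (eq j)))

lhs-as-D-sum : ∀ m e → ι (LHS m (suc e)) ≡ ℕ→ℚi (suc e) ⊛ ½ ⊛ (𝕚 ⊛ ∑[ j < m ] D m e j)
lhs-as-D-sum m e = begin
  ι (LHS m n)
    ≡⟨ lhs-as-bernoulliPoly m n ⟩
  κ n ⊛ (P u ⊕ ⊝ P (𝕚 ⊛ u) ⊕ (P (⊝ 1i ⊛ u) ⊕ ⊝ P (⊝ 𝕚 ⊛ u)))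
    ≡⟨ cong₂ (λ a b → κ n ⊛ (a ⊕ ⊝ P (𝕚 ⊛ u) ⊕ (P (⊝ 1i ⊛ u) ⊕ ⊝ b)))
             (trans (cong P (sym (𝕚⊛Mw⊕M≡Mw (ℕ→ℚi m)))) (bernoulliPoly-shift e (𝕚 ⊛ u) m))
             (trans (cong P (sym (⊝Mw⊕M≡⊝𝕚⊛Mw (ℕ→ℚi m)))) (bernoulliPoly-shift e (⊝ 1i ⊛ u) m)) ⟩
  κ n ⊛ (P (𝕚 ⊛ u) ⊕ c ⊛ S₊ ⊕ ⊝ P (𝕚 ⊛ u) ⊕ (P (⊝ 1i ⊛ u) ⊕ ⊝ (P (⊝ 1i ⊛ u) ⊕ c ⊛ S₋)))
    ≡⟨ telescope (P (𝕚 ⊛ u)) (P (⊝ 1i ⊛ u)) c (two ^i e) S₊ S₋ ⟩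
  c ⊛ ½ ⊛ (𝕚 ⊛ (two ^i e ⊛ S₋ ⊕ ⊝ (two ^i e ⊛ S₊)))
    ≡⟨ cong₂ (λ a b → c ⊛ ½ ⊛ (𝕚 ⊛ (a ⊕ ⊝ b)))
             (two^e⊛sum-of-powers e m (⊝ 1i ⊛ u) (λ j → A m j ⊖ ℕ→ℚi m ⊛ 𝕚) (two⊛[⊝mw⊕j]≡A-m𝕚 m))
             (two^e⊛sum-of-powers e m (𝕚 ⊛ u) (λ j → A m j ⊕ ℕ→ℚi m ⊛ 𝕚) (two⊛[𝕚mw⊕j]≡A+m𝕚 m)) ⟩
  c ⊛ ½ ⊛ (𝕚 ⊛ (∑[ j < m ] ((A m j ⊖ ℕ→ℚi m ⊛ 𝕚) ^i e) ⊖ ∑[ j < m ] ((A m j ⊕ ℕ→ℚi m ⊛ 𝕚) ^i e)))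
    ≡⟨ cong (λ s → c ⊛ ½ ⊛ (𝕚 ⊛ s))
            (sum-distrib-⊖ m (λ j → (A m j ⊖ ℕ→ℚi m ⊛ 𝕚) ^i e) (λ j → (A m j ⊕ ℕ→ℚi m ⊛ 𝕚) ^i e)) ⟨
  c ⊛ ½ ⊛ (𝕚 ⊛ ∑[ j < m ] D m e j) ∎
  where
  open ≡-Reasoning
  n = suc e
  c = ℕ→ℚi n
  u = ℕ→ℚi m ⊛ w
  P = bernoulliPoly n
  S₊ = ∑[ j < m ] ((𝕚 ⊛ u ⊕ ℕ→ℚi j) ^i e)
  S₋ = ∑[ j < m ] ((⊝ 1i ⊛ u ⊕ ℕ→ℚi j) ^i e)
  telescope : ∀ p q c T s t → ⊝ 𝕚 ⊛ (two ⊛ T) ⊛ ι (+ 1 / 4) ⊛ (p ⊕ c ⊛ s ⊕ ⊝ p ⊕ (q ⊕ ⊝ (q ⊕ c ⊛ t)))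
                              ≡ c ⊛ ½ ⊛ (𝕚 ⊛ (T ⊛ t ⊕ ⊝ (T ⊛ s)))
  telescope = solve-∀ ℚi-ring

-- Folding the sum and evaluating its end terms

A-reflect : ∀ m j → j ≤ m → A m (m ∸ j) ≡ ⊝ A m j
A-reflect m j j≤m = begin
  A m (m ∸ j)                                     ≡⟨ A≡2r-m m (m ∸ j) ⟩
  two ⊛ ℕ→ℚi (m ∸ j) ⊕ ⊝ ℕ→ℚi m                  ≡⟨ cong (λ z → two ⊛ ℕ→ℚi (m ∸ j) ⊕ ⊝ z) m≡m∸j+j ⟩
  two ⊛ ℕ→ℚi (m ∸ j) ⊕ ⊝ (ℕ→ℚi (m ∸ j) ⊕ ℕ→ℚi j) ≡⟨ reflect (ℕ→ℚi (m ∸ j)) (ℕ→ℚi j) ⟩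
  ⊝ (two ⊛ ℕ→ℚi j ⊕ ⊝ (ℕ→ℚi (m ∸ j) ⊕ ℕ→ℚi j))   ≡⟨ cong (λ z → ⊝ (two ⊛ ℕ→ℚi j ⊕ ⊝ z)) m≡m∸j+j ⟨
  ⊝ (two ⊛ ℕ→ℚi j ⊕ ⊝ ℕ→ℚi m)                    ≡⟨ cong ⊝_ (A≡2r-m m j) ⟨
  ⊝ A m j ∎
  where
  open ≡-Reasoning
  m≡m∸j+j : ℕ→ℚi m ≡ ℕ→ℚi (m ∸ j) ⊕ ℕ→ℚi j
  m≡m∸j+j = trans (cong ℕ→ℚi (sym (ℕ.m∸n+n≡m j≤m))) (ℕ→ℚi-homo-+ (m ∸ j) j)
  reflect : ∀ d J → two ⊛ d ⊕ ⊝ (d ⊕ J) ≡ ⊝ (two ⊛ J ⊕ ⊝ (d ⊕ J))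
  reflect = solve-∀ ℚi-ring

-- The exponent is odd, so reflecting r ↦ m − r, i.e. A ↦ −A, swaps the two powers in D.
D-reflect : ∀ m t j → j ≤ m → D m (suc (t ℕ.* 2)) (m ∸ j) ≡ D m (suc (t ℕ.* 2)) j
D-reflect m t j j≤m = begin
  (A m (m ∸ j) ⊖ c) ^i e ⊖ (A m (m ∸ j) ⊕ c) ^i e
    ≡⟨ cong (λ a → (a ⊖ c) ^i e ⊖ (a ⊕ c) ^i e) (A-reflect m j j≤m) ⟩
  (⊝ A m j ⊖ c) ^i e ⊖ (⊝ A m j ⊕ c) ^i e
    ≡⟨ cong₂ (λ a b → a ^i e ⊖ b ^i e) (lemma₁ (A m j) c) (lemma₂ (A m j) c) ⟩
  (⊝ (A m j ⊕ c)) ^i e ⊖ (⊝ (A m j ⊖ c)) ^i e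
    ≡⟨ cong₂ _⊖_ (⊝^i-odd (A m j ⊕ c) t) (⊝^i-odd (A m j ⊖ c) t) ⟩
  ⊝ (A m j ⊕ c) ^i e ⊖ ⊝ (A m j ⊖ c) ^i e
    ≡⟨ lemma₃ ((A m j ⊕ c) ^i e) ((A m j ⊖ c) ^i e) ⟩
  (A m j ⊖ c) ^i e ⊖ (A m j ⊕ c) ^i e ∎
  where
  open ≡-Reasoning
  e = suc (t ℕ.* 2)
  c = ℕ→ℚi m ⊛ 𝕚
  lemma₁ : ∀ a c → ⊝ a ⊕ ⊝ c ≡ ⊝ (a ⊕ c)
  lemma₁ = solve-∀ ℚi-ring
  lemma₂ : ∀ a c → ⊝ a ⊕ c ≡ ⊝ (a ⊕ ⊝ c)
  lemma₂ = solve-∀ ℚi-ring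
  lemma₃ : ∀ p q → ⊝ p ⊕ ⊝ ⊝ q ≡ q ⊕ ⊝ p
  lemma₃ = solve-∀ ℚi-ring

D-sum-fold : ∀ h k t → let m = suc (h ℕ.+ k ℕ.+ h) ; D′ = D m (suc (t ℕ.* 2)) in
  sum m D′ ≡ D′ 0 ⊕ (two ⊛ ∑[ r < h ] D′ (suc r) ⊕ ∑[ i < k ] D′ (suc h ℕ.+ i))
D-sum-fold h k t = cong (D′ 0 ⊕_) (sum-palindrome h k (D′ ∘ suc) mirror)
  where
  m = suc (h ℕ.+ k ℕ.+ h)
  D′ = D m (suc (t ℕ.* 2))
  index : ∀ j → j < h → suc (h ℕ.+ k ℕ.+ (h ∸ suc j)) ≡ m ∸ suc j
  index j j<h = begin
    suc (h ℕ.+ k ℕ.+ (h ∸ suc j))   ≡⟨ ℕ.+-suc (h ℕ.+ k) (h ∸ suc j) ⟨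
    h ℕ.+ k ℕ.+ suc (h ∸ suc j)     ≡⟨ cong (h ℕ.+ k ℕ.+_) (ℕ.+-∸-assoc 1 j<h) ⟨
    h ℕ.+ k ℕ.+ (h ∸ j)             ≡⟨ ℕ.+-∸-assoc (h ℕ.+ k) (ℕ.<⇒≤ j<h) ⟨
    h ℕ.+ k ℕ.+ h ∸ j ∎
    where open ≡-Reasoning
  mirror : ∀ j → j < h → D′ (suc (h ℕ.+ k ℕ.+ (h ∸ suc j))) ≡ D′ (suc j)
  mirror j j<h = trans (cong D′ (index j j<h))
    (D-reflect m t (suc j) (s≤s (ℕ.≤-trans (ℕ.<⇒≤ j<h) (ℕ.≤-trans (ℕ.m≤m+n h k) (ℕ.m≤m+n (h ℕ.+ k) h)))))

-- (−1)^⌊(n−2)/4⌋ 2^(n/2) for n = 2t + 2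
Y : ℕ → ℚi
Y t = (⊝ 1i) ^i ((t ℕ.* 2) ℕ./ 4) ⊛ two ^i suc t

-- Since (−1 ∓ 𝕚)⁴ = −4, the claim steps from t to t + 2.
𝕚⊛power-difference≡Y : ∀ t → let e = suc (t ℕ.* 2) in 𝕚 ⊛ ((⊝ 1i ⊖ 𝕚) ^i e ⊖ (⊝ 1i ⊕ 𝕚) ^i e) ≡ Y t
𝕚⊛power-difference≡Y zero          = refl
𝕚⊛power-difference≡Y (suc zero)    = refl
𝕚⊛power-difference≡Y (suc (suc t)) = begin
  𝕚 ⊛ (α ⊛ (α ⊛ (α ⊛ (α ⊛ α ^i e))) ⊖ β ⊛ (β ⊛ (β ⊛ (β ⊛ β ^i e))))
    ≡⟨ step (α ^i e) (β ^i e) ⟩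
  ⊝ 1i ⊛ (two ⊛ two) ⊛ (𝕚 ⊛ (α ^i e ⊖ β ^i e))
    ≡⟨ cong (⊝ 1i ⊛ (two ⊛ two) ⊛_) (𝕚⊛power-difference≡Y t) ⟩
  ⊝ 1i ⊛ (two ⊛ two) ⊛ ((⊝ 1i) ^i q ⊛ two ^i suc t)
    ≡⟨ regroup ((⊝ 1i) ^i q) (two ^i suc t) ⟩
  (⊝ 1i) ^i suc q ⊛ two ^i suc (suc (suc t))
    ≡⟨ cong (λ k → (⊝ 1i) ^i k ⊛ two ^i suc (suc (suc t))) (m/n≡1+[m∸n]/n (ℕ.m≤m+n 4 (t ℕ.* 2))) ⟨
  Y (suc (suc t)) ∎
  where
  open ≡-Reasoning
  α = ⊝ 1i ⊖ 𝕚
  β = ⊝ 1i ⊕ 𝕚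
  e = suc (t ℕ.* 2)
  q = (t ℕ.* 2) ℕ./ 4
  step : ∀ a b → 𝕚 ⊛ (α ⊛ (α ⊛ (α ⊛ (α ⊛ a))) ⊕ ⊝ (β ⊛ (β ⊛ (β ⊛ (β ⊛ b)))))
                 ≡ ⊝ 1i ⊛ (two ⊛ two) ⊛ (𝕚 ⊛ (a ⊕ ⊝ b))
  step = solve-∀ ℚi-ring
  regroup : ∀ p x → ⊝ 1i ⊛ (two ⊛ two) ⊛ (p ⊛ x) ≡ ⊝ 1i ⊛ p ⊛ (two ⊛ (two ⊛ x))
  regroup = solve-∀ ℚi-ring

𝕚⊛D[0] : ∀ m t → 𝕚 ⊛ D m (suc (t ℕ.* 2)) 0 ≡ ℕ→ℚi m ^i suc (t ℕ.* 2) ⊛ Y t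
𝕚⊛D[0] m t = begin
  𝕚 ⊛ ((A m 0 ⊖ c) ^i e ⊖ (A m 0 ⊕ c) ^i e)
    ≡⟨ cong₂ (λ a b → 𝕚 ⊛ (a ^i e ⊖ b ^i e)) -m-m𝕚 -m+m𝕚 ⟩
  𝕚 ⊛ ((ℕ→ℚi m ⊛ (⊝ 1i ⊖ 𝕚)) ^i e ⊖ (ℕ→ℚi m ⊛ (⊝ 1i ⊕ 𝕚)) ^i e)
    ≡⟨ cong₂ (λ a b → 𝕚 ⊛ (a ⊖ b)) (^i-distrib-⊛ (ℕ→ℚi m) _ e) (^i-distrib-⊛ (ℕ→ℚi m) _ e) ⟩
  𝕚 ⊛ (M ⊛ (⊝ 1i ⊖ 𝕚) ^i e ⊖ M ⊛ (⊝ 1i ⊕ 𝕚) ^i e)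
    ≡⟨ factor M ((⊝ 1i ⊖ 𝕚) ^i e) ((⊝ 1i ⊕ 𝕚) ^i e) ⟩
  M ⊛ (𝕚 ⊛ ((⊝ 1i ⊖ 𝕚) ^i e ⊖ (⊝ 1i ⊕ 𝕚) ^i e))
    ≡⟨ cong (M ⊛_) (𝕚⊛power-difference≡Y t) ⟩
  M ⊛ Y t ∎
  where
  open ≡-Reasoning
  e = suc (t ℕ.* 2)
  c = ℕ→ℚi m ⊛ 𝕚
  M = ℕ→ℚi m ^i e
  A₀≡-m : A m 0 ≡ ⊝ ℕ→ℚi m
  A₀≡-m = trans (A≡2r-m m 0) (lemma (ℕ→ℚi m))
    where
    lemma : ∀ M → two ⊛ 0i ⊕ ⊝ M ≡ ⊝ M
    lemma = solve-∀ ℚi-ring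
  -m-m𝕚 : A m 0 ⊖ c ≡ ℕ→ℚi m ⊛ (⊝ 1i ⊖ 𝕚)
  -m-m𝕚 = trans (cong (_⊖ c) A₀≡-m) (lemma (ℕ→ℚi m))
    where
    lemma : ∀ M → ⊝ M ⊕ ⊝ (M ⊛ 𝕚) ≡ M ⊛ (⊝ 1i ⊕ ⊝ 𝕚)
    lemma = solve-∀ ℚi-ring
  -m+m𝕚 : A m 0 ⊕ c ≡ ℕ→ℚi m ⊛ (⊝ 1i ⊕ 𝕚)
  -m+m𝕚 = trans (cong (_⊕ c) A₀≡-m) (lemma (ℕ→ℚi m))
    where
    lemma : ∀ M → ⊝ M ⊕ M ⊛ 𝕚 ≡ M ⊛ (⊝ 1i ⊕ 𝕚)
    lemma = solve-∀ ℚi-ring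
  factor : ∀ M a b → 𝕚 ⊛ (M ⊛ a ⊕ ⊝ (M ⊛ b)) ≡ M ⊛ (𝕚 ⊛ (a ⊕ ⊝ b))
  factor = solve-∀ ℚi-ring

𝕚⊛D[m/2] : ∀ m h t → m ≡ suc h ℕ.* 2 → let e = suc (t ℕ.* 2) in
  𝕚 ⊛ D m e (suc h) ≡ ℕ→ℚi m ^i e ⊛ ⊝ (two ⊛ (⊝ 1i) ^i suc t)
𝕚⊛D[m/2] m h t refl = begin
  𝕚 ⊛ ((A m (suc h) ⊖ c) ^i e ⊖ (A m (suc h) ⊕ c) ^i e)
    ≡⟨ cong (λ a → 𝕚 ⊛ ((a ⊖ c) ^i e ⊖ (a ⊕ c) ^i e)) A[m/2]≡0 ⟩
  𝕚 ⊛ ((0i ⊖ c) ^i e ⊖ (0i ⊕ c) ^i e)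
    ≡⟨ cong₂ (λ a b → 𝕚 ⊛ (a ^i e ⊖ b ^i e)) (⊕-identityˡ (⊝ c)) (⊕-identityˡ c) ⟩
  𝕚 ⊛ ((⊝ c) ^i e ⊖ c ^i e)
    ≡⟨ cong (λ a → 𝕚 ⊛ (a ⊖ c ^i e)) (⊝^i-odd c t) ⟩
  𝕚 ⊛ (⊝ c ^i e ⊖ c ^i e)
    ≡⟨ cong (λ a → 𝕚 ⊛ (⊝ a ⊖ a)) (^i-distrib-⊛ (ℕ→ℚi m) 𝕚 e) ⟩
  𝕚 ⊛ (⊝ (M ⊛ 𝕚 ^i e) ⊖ M ⊛ 𝕚 ^i e)
    ≡⟨ regroup M (𝕚 ^i e) ⟩
  M ⊛ ⊝ (two ⊛ (𝕚 ⊛ 𝕚 ^i e))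
    ≡⟨ cong (λ x → M ⊛ ⊝ (two ⊛ x)) (𝕚^[2k]≡[-1]^k (suc t)) ⟩
  M ⊛ ⊝ (two ⊛ (⊝ 1i) ^i suc t) ∎
  where
  open ≡-Reasoning
  e = suc (t ℕ.* 2)
  c = ℕ→ℚi m ⊛ 𝕚
  M = ℕ→ℚi m ^i e
  A[m/2]≡0 : A m (suc h) ≡ 0i
  A[m/2]≡0 = trans (A≡2r-m m (suc h)) (trans (cong (λ x → two ⊛ ℕ→ℚi (suc h) ⊕ ⊝ x) (ℕ→ℚi-homo-* (suc h) 2))
                                                (cancel (ℕ→ℚi (suc h))))
    where
    cancel : ∀ R → two ⊛ R ⊕ ⊝ (R ⊛ two) ≡ 0i
    cancel = solve-∀ ℚi-ring
  regroup : ∀ M I → 𝕚 ⊛ (⊝ (M ⊛ I) ⊕ ⊝ (M ⊛ I)) ≡ M ⊛ ⊝ (two ⊛ (𝕚 ⊛ I))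
  regroup = solve-∀ ℚi-ring

-- The middle term r = m/2 exists only for even m (k = 1); for odd m both sides vanish.
𝕚⊛D-middle : ∀ h k t → k < 2 → let m = suc (h ℕ.+ k ℕ.+ h) ; e = suc (t ℕ.* 2) in
  𝕚 ⊛ ∑[ i < k ] D m e (suc h ℕ.+ i) ≡ ℕ→ℚi m ^i e ⊛ ⊝ ((1i ⊕ (⊝ 1i) ^i m) ⊛ (⊝ 1i) ^i suc t)
𝕚⊛D-middle h zero t _ = begin
  𝕚 ⊛ 0i
    ≡⟨ ⊛-zeroʳ 𝕚 ⟩
  0i
    ≡⟨ vanish (ℕ→ℚi m ^i e) ((⊝ 1i) ^i suc t) ⟨
  ℕ→ℚi m ^i e ⊛ ⊝ ((1i ⊕ ⊝ 1i) ⊛ (⊝ 1i) ^i suc t)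
    ≡⟨ cong (λ x → ℕ→ℚi m ^i e ⊛ ⊝ ((1i ⊕ x) ⊛ (⊝ 1i) ^i suc t)) [-1]^m ⟨
  ℕ→ℚi m ^i e ⊛ ⊝ ((1i ⊕ (⊝ 1i) ^i m) ⊛ (⊝ 1i) ^i suc t) ∎
  where
  open ≡-Reasoning
  m = suc (h ℕ.+ 0 ℕ.+ h)
  e = suc (t ℕ.* 2)
  h+0+h≡h*2 : h ℕ.+ 0 ℕ.+ h ≡ h ℕ.* 2
  h+0+h≡h*2 = ℕ-Solver.solve (h ∷ [])
  [-1]^m : (⊝ 1i) ^i m ≡ ⊝ 1i
  [-1]^m = begin
    (⊝ 1i) ^i suc (h ℕ.+ 0 ℕ.+ h)   ≡⟨ cong (λ x → (⊝ 1i) ^i suc x) h+0+h≡h*2 ⟩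
    (⊝ 1i) ^i suc (h ℕ.* 2)         ≡⟨ ⊝^i-odd 1i h ⟩
    ⊝ (1i ^i suc (h ℕ.* 2))         ≡⟨ cong ⊝_ (1^i≡1 (suc (h ℕ.* 2))) ⟩
    ⊝ 1i ∎
  vanish : ∀ M p → M ⊛ ⊝ ((1i ⊕ ⊝ 1i) ⊛ p) ≡ 0i
  vanish = solve-∀ ℚi-ring
𝕚⊛D-middle h (suc zero) t _ = begin
  𝕚 ⊛ (D m e (suc h ℕ.+ 0) ⊕ 0i)
    ≡⟨ cong (𝕚 ⊛_) (trans (⊕-identityʳ _) (cong (D m e) (ℕ.+-identityʳ (suc h)))) ⟩
  𝕚 ⊛ D m e (suc h)
    ≡⟨ 𝕚⊛D[m/2] m h t m≡[1+h]*2 ⟩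
  M ⊛ ⊝ (two ⊛ (⊝ 1i) ^i suc t)
    ≡⟨ two≡1+1 M ((⊝ 1i) ^i suc t) ⟩
  M ⊛ ⊝ ((1i ⊕ 1i) ⊛ (⊝ 1i) ^i suc t)
    ≡⟨ cong (λ x → M ⊛ ⊝ ((1i ⊕ x) ⊛ (⊝ 1i) ^i suc t)) [-1]^m ⟨
  M ⊛ ⊝ ((1i ⊕ (⊝ 1i) ^i m) ⊛ (⊝ 1i) ^i suc t) ∎
  where
  open ≡-Reasoning
  m = suc (h ℕ.+ 1 ℕ.+ h)
  e = suc (t ℕ.* 2)
  M = ℕ→ℚi m ^i e
  m≡[1+h]*2 : suc (h ℕ.+ 1 ℕ.+ h) ≡ suc h ℕ.* 2
  m≡[1+h]*2 = ℕ-Solver.solve (h ∷ [])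
  [-1]^m : (⊝ 1i) ^i m ≡ 1i
  [-1]^m = trans (cong ((⊝ 1i) ^i_) m≡[1+h]*2) ([-1]^[2k]≡1 (suc h))
  two≡1+1 : ∀ M p → M ⊛ ⊝ (two ⊛ p) ≡ M ⊛ ⊝ ((1i ⊕ 1i) ⊛ p)
  two≡1+1 = solve-∀ ℚi-ring
𝕚⊛D-middle h (suc (suc _)) t (s≤s (s≤s ()))

𝕚⊛sum-D : ∀ m h k t → m ≡ suc (h ℕ.+ k ℕ.+ h) → k < 2 → let e = suc (t ℕ.* 2) in
  𝕚 ⊛ sum m (D m e)
    ≡ ℕ→ℚi m ^i e ⊛ (Y t ⊕ ⊝ ((1i ⊕ (⊝ 1i) ^i m) ⊛ (⊝ 1i) ^i suc t)) ⊕ two ⊛ 𝕚 ⊛ ∑[ r < h ] D m e (suc r)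
𝕚⊛sum-D m h k t refl k<2 = begin
  𝕚 ⊛ sum m D′
    ≡⟨ cong (𝕚 ⊛_) (D-sum-fold h k t) ⟩
  𝕚 ⊛ (D′ 0 ⊕ (two ⊛ S ⊕ middle))
    ≡⟨ distribute (D′ 0) S middle ⟩
  𝕚 ⊛ D′ 0 ⊕ 𝕚 ⊛ middle ⊕ two ⊛ 𝕚 ⊛ S
    ≡⟨ cong₂ (λ a b → a ⊕ b ⊕ two ⊛ 𝕚 ⊛ S) (𝕚⊛D[0] m t) (𝕚⊛D-middle h k t k<2) ⟩
  M ⊛ Y t ⊕ M ⊛ ⊝ Z ⊕ two ⊛ 𝕚 ⊛ S
    ≡⟨ factor M (Y t) Z (two ⊛ 𝕚 ⊛ S) ⟩
  M ⊛ (Y t ⊕ ⊝ Z) ⊕ two ⊛ 𝕚 ⊛ S ∎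
  where
  open ≡-Reasoning
  e = suc (t ℕ.* 2)
  D′ = D m e
  M = ℕ→ℚi m ^i e
  S = ∑[ r < h ] D′ (suc r)
  middle = ∑[ i < k ] D′ (suc h ℕ.+ i)
  Z = (1i ⊕ (⊝ 1i) ^i m) ⊛ (⊝ 1i) ^i suc t
  distribute : ∀ d s c → 𝕚 ⊛ (d ⊕ (two ⊛ s ⊕ c)) ≡ 𝕚 ⊛ d ⊕ 𝕚 ⊛ c ⊕ two ⊛ 𝕚 ⊛ s
  distribute = solve-∀ ℚi-ring
  factor : ∀ M y z s → M ⊛ y ⊕ M ⊛ ⊝ z ⊕ s ≡ M ⊛ (y ⊕ ⊝ z) ⊕ s
  factor = solve-∀ ℚi-ring

rhs-bracket : ∀ m t → let n = suc (suc (t ℕ.* 2)) in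
  ι ((ℕ→ℚ m ^ℚ (n ∸ 1)) ℚ.*
     (((ℚ.- 1ℚ) ^ℚ ((n ∸ 2) ℕ./ 4)) ℚ.* (ℕ→ℚ 2 ^ℚ (n ℕ./ 2))
      ℚ.- ((1ℚ ℚ.+ ((ℚ.- 1ℚ) ^ℚ m)) ℚ.* ((ℚ.- 1ℚ) ^ℚ (n ℕ./ 2)))))
    ≡ ℕ→ℚi m ^i suc (t ℕ.* 2) ⊛ (Y t ⊕ ⊝ ((1i ⊕ (⊝ 1i) ^i m) ⊛ (⊝ 1i) ^i suc t))
rhs-bracket m t = trans (ι-homo-* (ℕ→ℚ m ^ℚ suc (t ℕ.* 2)) (x ℚ.- z)) (cong₂ _⊛_
  (ι-homo-^ (ℕ→ℚ m) (suc (t ℕ.* 2)))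
  (cong₂ (λ a b → a ⊕ ⊝ b)
    (trans (ι-homo-* ((ℚ.- 1ℚ) ^ℚ ((t ℕ.* 2) ℕ./ 4)) (ℕ→ℚ 2 ^ℚ (n ℕ./ 2)))
           (cong₂ _⊛_ (ι-homo-^ (ℚ.- 1ℚ) ((t ℕ.* 2) ℕ./ 4))
                      (trans (ι-homo-^ (ℕ→ℚ 2) (n ℕ./ 2)) (cong (two ^i_) n/2≡1+t))))
    (trans (ι-homo-* (1ℚ ℚ.+ ((ℚ.- 1ℚ) ^ℚ m)) ((ℚ.- 1ℚ) ^ℚ (n ℕ./ 2)))
           (cong₂ _⊛_ (cong (1i ⊕_) (ι-homo-^ (ℚ.- 1ℚ) m))
                      (trans (ι-homo-^ (ℚ.- 1ℚ) (n ℕ./ 2)) (cong ((⊝ 1i) ^i_) n/2≡1+t))))))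
  where
  n = suc (suc (t ℕ.* 2))
  x = ((ℚ.- 1ℚ) ^ℚ ((t ℕ.* 2) ℕ./ 4)) ℚ.* (ℕ→ℚ 2 ^ℚ (n ℕ./ 2))
  z = (1ℚ ℚ.+ ((ℚ.- 1ℚ) ^ℚ m)) ℚ.* ((ℚ.- 1ℚ) ^ℚ (n ℕ./ 2))
  n/2≡1+t : n ℕ./ 2 ≡ suc t
  n/2≡1+t = m*n/n≡m (suc t) 2

m≡[m/2]+[m%2]+[m/2] : ∀ m → m ≡ m ℕ./ 2 ℕ.+ m ℕ.% 2 ℕ.+ m ℕ./ 2
m≡[m/2]+[m%2]+[m/2] m = trans (m≡m%n+[m/n]*n m 2) (rearrange (m ℕ.% 2) (m ℕ./ 2))
  where
  rearrange : ∀ r q → r ℕ.+ q ℕ.* 2 ≡ q ℕ.+ r ℕ.+ q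
  rearrange = ℕ-Solver.solve-∀

theorem2p4 : (m n : ℕ) → 1 ≤ m → 2 ≤ n → 2 ∣ n →
    ι (LHS m n) ≡ RHS m n
theorem2p4 (suc m′) n _ 2≤n (divides zero refl) = contradiction 2≤n λ ()
theorem2p4 (suc m′) n _ _   (divides (suc t) refl) = begin
  ι (LHS m n)
    ≡⟨ lhs-as-D-sum m e ⟩
  ℕ→ℚi n ⊛ ½ ⊛ (𝕚 ⊛ sum m (D m e))
    ≡⟨ cong (ℕ→ℚi n ⊛ ½ ⊛_) (𝕚⊛sum-D m h k t m≡h+k+h (m%n<n m′ 2)) ⟩
  ℕ→ℚi n ⊛ ½ ⊛ (ℕ→ℚi m ^i e ⊛ (Y t ⊕ ⊝ ((1i ⊕ (⊝ 1i) ^i m) ⊛ (⊝ 1i) ^i suc t)) ⊕ two ⊛ 𝕚 ⊛ ∑[ r < h ] D m e (suc r))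
    ≡⟨ cong₂ _⊛_ (ι-homo-* (ℕ→ℚ n) (+ 1 / 2))
                 (cong₂ _⊕_ (rhs-bracket m t) (cong (two ⊛ 𝕚 ⊛_) (Σi≡sum h 1 h (D m e) refl))) ⟨
  RHS m n ∎
  where
  open ≡-Reasoning
  m = suc m′
  e = suc (t ℕ.* 2)
  h = m′ ℕ./ 2
  k = m′ ℕ.% 2
  m≡h+k+h : m ≡ suc (h ℕ.+ k ℕ.+ h)
  m≡h+k+h = cong suc (m≡[m/2]+[m%2]+[m/2] m′)
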